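{- Let $r\ge 1$, $n=r+2$ and let $m$ be an integer with $\binom{r+1}{2}\le m\le \frac{(r+2)r}{2}$. Among all graphs of order $n$, size $m$ and maximum degree at most $r$, the unique (up to isomorphism) graph $G$ attaining the maximum number of triangles is the one whose complement $\overline G$ is the vertex-disjoint union of a matching with $m-\binom{r+1}{2}$ edges and a star on $(r+1)^2+1-2m$ vertices.
   Context: Graphs are finite and simple; a star on $s$ vertices is $K_{1,s-1}$; $\overline G$ denotes the complement of $G$. -}

module Defs where

open import Data.Nat using (ℕ; zero; suc; _+_; _*_; _≤_; _/_)
open import Data.Nat.Combinatorics using (_C_)
open import Data.Fin using (Fin; zero; suc; toℕ; splitAt; _≟_; _<?_)
open import Data.Bool using (Bool; true; false; _∧_; _∨_; not; if_then_else_)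
open import Data.Bool.Properties using (∨-comm)
open import Data.Sum using (_⊎_; inj₁; inj₂)
open import Data.Product using (Σ; _×_; _,_)
open import Function.Bundles using (_↔_; Inverse)
open import Relation.Nullary using (yes; no)
open import Relation.Nullary.Decidable using (⌊_⌋)
open import Relation.Binary.PropositionalEquality using (_≡_; refl; sym; cong₂)
import Data.Nat as ℕ

record Graph (n : ℕ) : Set where
  field
    adj    : Fin n → Fin n → Bool
    adj-sym    : ∀ i j → adj i j ≡ adj j i
    adj-irrefl : ∀ i → adj i i ≡ false
open Graph public

neq : ∀ {n} → Fin n → Fin n → Bool
neq i j = not ⌊ i ≟ j ⌋

neq-sym : ∀ {n} (i j : Fin n) → neq i j ≡ neq j i
neq-sym i j with i ≟ j | j ≟ i
... | yes _ | yes _ = refl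
... | no _  | no _  = refl
... | yes p | no q  = Data.Empty.⊥-elim (q (sym p))
  where import Data.Empty
... | no q  | yes p = Data.Empty.⊥-elim (q (sym p))
  where import Data.Empty

neq-refl : ∀ {n} (i : Fin n) → neq i i ≡ false
neq-refl i with i ≟ i
... | yes _ = refl
... | no q  = Data.Empty.⊥-elim (q refl)
  where import Data.Empty

-- Build a simple graph from any Boolean relation: i ~ j iff i ≠ j and (f i j or f j i).
-- (All relations we use below are already symmetric, so this only adds the proofs.)
mkGraph : ∀ {n} → (Fin n → Fin n → Bool) → Graph n
mkGraph f = record
  { adj = λ i j → neq i j ∧ (f i j ∨ f j i)
  ; adj-sym = λ i j → cong₂ _∧_ (neq-sym i j) (∨-comm (f i j) (f j i))
  ; adj-irrefl = λ i → cong₂ _∧_ (neq-refl i) refl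
  }

complement : ∀ {n} → Graph n → Graph n
complement G = mkGraph (λ i j → not (adj G i j))

-- Vertex-disjoint union: vertices of A come first, then those of B.
disjointUnion : ∀ {a b} → Graph a → Graph b → Graph (a + b)
disjointUnion {a} A B = mkGraph f
  where
  f : Fin (a + _) → Fin (a + _) → Bool
  f i j with splitAt a i | splitAt a j
  ... | inj₁ x | inj₁ y = adj A x y
  ... | inj₂ x | inj₂ y = adj B x y
  ... | _      | _      = false

-- Perfect matching with k edges on 2k vertices: edges {0,1},{2,3},…
matching : (k : ℕ) → Graph (2 * k)
matching k = mkGraph (λ i j → ⌊ toℕ i / 2 ℕ.≟ toℕ j / 2 ⌋)

-- The star on s vertices, K_{1,s-1}, with centre 0 (empty graph when s = 0).
star : (s : ℕ) → Graph s
star s = mkGraph f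
  where
  f : Fin s → Fin s → Bool
  f zero _ = true
  f _ zero = true
  f _ _    = false

sumF : ∀ {n} → (Fin n → ℕ) → ℕ
sumF {zero}  f = 0
sumF {suc n} f = f zero + sumF (λ i → f (suc i))

count : ∀ {n} → (Fin n → Bool) → ℕ
count f = sumF (λ i → if f i then 1 else 0)

lt : ∀ {n} → Fin n → Fin n → Bool
lt i j = ⌊ i <? j ⌋

degree : ∀ {n} → Graph n → Fin n → ℕ
degree G v = count (adj G v)

size : ∀ {n} → Graph n → ℕ
size G = sumF (λ i → count (λ j → lt i j ∧ adj G i j))

triangles : ∀ {n} → Graph n → ℕ
triangles G = sumF (λ i → sumF (λ j → count (λ k →
  lt i j ∧ lt j k ∧ adj G i j ∧ adj G j k ∧ adj G i k)))

MaxDegreeAtMost : ∀ {n} → Graph n → ℕ → Set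
MaxDegreeAtMost G r = ∀ v → degree G v ≤ r

_≅_ : ∀ {a b} → Graph a → Graph b → Set
_≅_ {a} {b} G H = Σ (Fin a ↔ Fin b) λ φ →
  ∀ i j → adj G i j ≡ adj H (Inverse.to φ i) (Inverse.to φ j)

module Submission where

-- Let X be the complement of G; Δ(G) ≤ r = n − 2 says that
-- X has no isolated vertex.  Counting over vertex triples (Goodman) gives
--     t(G) + t(X) + (n − 2)·e(X) = C(n,3) + Σ_v C(d_X(v), 2),
-- and with d_X(v) = 1 + g(v), g ≥ 0, the exact convexity identity
--     Σ_v C(1 + g(v), 2) + Σ_{u<v} g(u) g(v) = C(1 + Σ_v g(v), 2)
-- shows that t(G) + t(X) + Σ_{u<v} g(u) g(v) only depends on n and e(X).  For
-- U = M_k ∪ S_s, the complement of the claimed extremal graph H, both t(U) and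
-- the g-products vanish, hence t(H) = t(G) + t(X) + Σ_{u<v} g(u) g(v) ≥ t(G).
-- In case of equality X has a single vertex of degree ≠ 1, and ranking its
-- leaves and the remaining matched pairs yields an isomorphism X ≅ U, G ≅ H.

open import Defs
open import Data.Nat using (ℕ; zero; suc; _+_; _*_; _∸_; _^_; _≤_; _<_; z≤n; s≤s; s≤s⁻¹; _<ᵇ_; _≡ᵇ_; _/_)
import Data.Nat as ℕ
open import Data.Nat.Properties hiding (_≟_; _<?_)
open import Data.Nat.Combinatorics using (_C_; nCk+nC[k+1]≡[n+1]C[k+1]; nC1≡n)
open import Data.Nat.DivMod using (m/n≡1+[m∸n]/n)
open import Data.Nat.Tactic.RingSolver using (solve-∀)
open import Data.Fin using (Fin; zero; suc; toℕ; _≟_; _<?_; fromℕ<; _↑ˡ_; _↑ʳ_; splitAt; punchOut)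
import Data.Fin.Properties as Finₚ
open import Data.Fin.Properties
  using (toℕ-injective; toℕ<n; toℕ-fromℕ<; ↑ˡ-injective; ↑ʳ-injective;
         splitAt-↑ˡ; splitAt-↑ʳ; join-splitAt; punchOut-injective; injective⇒≤; any?)
  renaming (suc-injective to Fin-suc-injective)
open import Data.Bool using (Bool; true; false; _∧_; _∨_; not; if_then_else_; T)
open import Data.Bool.Properties using (∧-zeroʳ)
open import Data.Empty using (⊥; ⊥-elim)
open import Data.Product using (Σ; _,_; proj₁; proj₂; _×_)
open import Data.Sum using (_⊎_; inj₁; inj₂)
open import Function.Bundles using (_↔_; mk↔ₛ′)
open import Relation.Binary.Definitions using (tri<; tri≈; tri>)
open import Relation.Binary.PropositionalEquality
open import Relation.Nullary using (yes; no; ¬_; does)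
open import Relation.Nullary.Decidable using (⌊_⌋; isYes≗does)

-- Finite sums  Σ_{i : Fin n} f i  (Defs.sumF)

sumF-cong : ∀ {n} {f g : Fin n → ℕ} → (∀ i → f i ≡ g i) → sumF f ≡ sumF g
sumF-cong {zero}  e = refl
sumF-cong {suc n} e = cong₂ _+_ (e zero) (sumF-cong (λ i → e (suc i)))

sumF-+ : ∀ {n} (f g : Fin n → ℕ) → sumF (λ i → f i + g i) ≡ sumF f + sumF g
sumF-+ {zero}  f g = refl
sumF-+ {suc n} f g =
  trans (cong (f zero + g zero +_) (sumF-+ (λ i → f (suc i)) (λ i → g (suc i))))
        (+-interchange (f zero) (g zero) _ _)
  where
  +-interchange : ∀ a b c d → a + b + (c + d) ≡ a + c + (b + d)
  +-interchange = solve-∀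

sumF-*ˡ : ∀ {n} (c : ℕ) (f : Fin n → ℕ) → sumF (λ i → c * f i) ≡ c * sumF f
sumF-*ˡ {zero}  c f = sym (*-zeroʳ c)
sumF-*ˡ {suc n} c f =
  trans (cong (c * f zero +_) (sumF-*ˡ c (λ i → f (suc i)))) (sym (*-distribˡ-+ c (f zero) _))

sumF-0 : ∀ {n} → sumF {n} (λ _ → 0) ≡ 0
sumF-0 {zero}  = refl
sumF-0 {suc n} = sumF-0 {n}

sumF-1 : ∀ {n} → sumF {n} (λ _ → 1) ≡ n
sumF-1 {zero}  = refl
sumF-1 {suc n} = cong suc (sumF-1 {n})

sumF-swap : ∀ {m n} (f : Fin m → Fin n → ℕ) →
  sumF (λ i → sumF (λ j → f i j)) ≡ sumF (λ j → sumF (λ i → f i j))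
sumF-swap {zero}  {n} f = sym (sumF-0 {n})
sumF-swap {suc m} {n} f =
  trans (cong (sumF (f zero) +_) (sumF-swap (λ i → f (suc i))))
        (sym (sumF-+ (f zero) (λ j → sumF (λ i → f (suc i) j))))

sumF-mono : ∀ {n} {f g : Fin n → ℕ} → (∀ i → f i ≤ g i) → sumF f ≤ sumF g
sumF-mono {zero}  h = z≤n
sumF-mono {suc n} h = +-mono-≤ (h zero) (sumF-mono (λ i → h (suc i)))

sumF-mono-< : ∀ {n} {f g : Fin n → ℕ} → (∀ i → f i ≤ g i) → (a : Fin n) → f a < g a → sumF f < sumF g
sumF-mono-< {suc n} h zero    p = +-mono-<-≤ p (sumF-mono (λ i → h (suc i)))
sumF-mono-< {suc n} h (suc a) p = +-mono-≤-< (h zero) (sumF-mono-< (λ i → h (suc i)) a p)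

sumF-≡0 : ∀ {n} (f : Fin n → ℕ) → sumF f ≡ 0 → ∀ a → f a ≡ 0
sumF-≡0 {suc n} f e zero    = m+n≡0⇒m≡0 (f zero) e
sumF-≡0 {suc n} f e (suc a) = sumF-≡0 (λ i → f (suc i)) (m+n≡0⇒n≡0 (f zero) e) a

sumF-split : ∀ a b (f : Fin (a + b) → ℕ) → sumF f ≡ sumF (λ x → f (x ↑ˡ b)) + sumF (λ y → f (a ↑ʳ y))
sumF-split zero    b f = refl
sumF-split (suc a) b f =
  trans (cong (f zero +_) (sumF-split a b (λ i → f (suc i)))) (sym (+-assoc (f zero) _ _))

sumR : ℕ → (ℕ → ℕ) → ℕ
sumR zero    h = 0
sumR (suc m) h = h 0 + sumR m (λ y → h (suc y))

sumF-toℕ : ∀ {m} (h : ℕ → ℕ) → sumF {m} (λ y → h (toℕ y)) ≡ sumR m h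
sumF-toℕ {zero}  h = refl
sumF-toℕ {suc m} h = cong (h 0 +_) (sumF-toℕ {m} (λ y → h (suc y)))

sumR-cong : ∀ m {h g : ℕ → ℕ} → (∀ y → h y ≡ g y) → sumR m h ≡ sumR m g
sumR-cong zero    e = refl
sumR-cong (suc m) e = cong₂ _+_ (e 0) (sumR-cong m (λ y → e (suc y)))

sumR-0 : ∀ m → sumR m (λ _ → 0) ≡ 0
sumR-0 zero    = refl
sumR-0 (suc m) = sumR-0 m

ι : Bool → ℕ
ι b = if b then 1 else 0

ι-∧ : ∀ a b → ι (a ∧ b) ≡ ι a * ι b
ι-∧ true  b = sym (+-identityʳ (ι b))
ι-∧ false b = refl

ι≤1 : ∀ b → ι b ≤ 1
ι≤1 true  = s≤s z≤n
ι≤1 false = z≤n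

eqb : ∀ {n} → Fin n → Fin n → Bool
eqb i j = ⌊ i ≟ j ⌋

eqb-true : ∀ {n} {i j : Fin n} → i ≡ j → eqb i j ≡ true
eqb-true {i = i} {j} p with i ≟ j
... | yes _ = refl
... | no ¬p = ⊥-elim (¬p p)

eqb-false : ∀ {n} {i j : Fin n} → ¬ i ≡ j → eqb i j ≡ false
eqb-false {i = i} {j} ¬p with i ≟ j
... | yes p = ⊥-elim (¬p p)
... | no _  = refl

eqb-sound : ∀ {n} {i j : Fin n} → eqb i j ≡ true → i ≡ j
eqb-sound {i = i} {j} e with i ≟ j
... | yes p = p

eqb-sym : ∀ {n} (i j : Fin n) → eqb i j ≡ eqb j i
eqb-sym i j with i ≟ j
... | yes p = sym (eqb-true (sym p))
... | no ¬p = sym (eqb-false (λ q → ¬p (sym q)))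

lt-true : ∀ {n} {i j : Fin n} → toℕ i < toℕ j → lt i j ≡ true
lt-true {i = i} {j} p with i <? j
... | yes _ = refl
... | no ¬p = ⊥-elim (¬p p)

lt-false : ∀ {n} {i j : Fin n} → ¬ (toℕ i < toℕ j) → lt i j ≡ false
lt-false {i = i} {j} ¬p with i <? j
... | yes p = ⊥-elim (¬p p)
... | no _  = refl

lt-sound : ∀ {n} {i j : Fin n} → lt i j ≡ true → toℕ i < toℕ j
lt-sound {i = i} {j} e with i <? j
... | yes p = p

lt⇒≢ : ∀ {n} {i j : Fin n} → lt i j ≡ true → ¬ i ≡ j
lt⇒≢ e refl = <-irrefl refl (lt-sound e)

lt-flip : ∀ {n} {a b : Fin n} → ¬ a ≡ b → lt b a ≡ not (lt a b)
lt-flip {a = a} {b} ne with Finₚ.<-cmp a b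
... | tri< p _ _ rewrite lt-true p | lt-false {i = b} {a} (<⇒≯ p) = refl
... | tri≈ _ q _ = ⊥-elim (ne q)
... | tri> _ _ p rewrite lt-true p | lt-false {i = a} {b} (<⇒≯ p) = refl

-- [i < j] as a number; multiplying by it restricts a sum to ordered pairs.
L : ∀ {n} → Fin n → Fin n → ℕ
L i j = ι (lt i j)

L-irr : ∀ {n} (i : Fin n) → L i i ≡ 0
L-irr i = cong ι (lt-false (n≮n (toℕ i)))

L-suc : ∀ {n} (i j : Fin n) → L (suc i) (suc j) ≡ L i j
L-suc i j = cong ι (trans (isYes≗does (suc i <? suc j)) (sym (isYes≗does (i <? j))))

L-trans : ∀ {n} (i j k : Fin n) → L i j * L j k * L i k ≡ L i j * L j k
L-trans i j k with lt i j in e₁ | lt j k in e₂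
... | false | _     = refl
... | true  | false = refl
... | true  | true  rewrite lt-true {i = i} {k} (<-trans (lt-sound e₁) (lt-sound e₂)) = refl

-- The order indicators computed on natural numbers, where the identities below
-- follow by recursion on the arguments.
lb : ℕ → ℕ → ℕ
lb x y = ι (x <ᵇ y)

eb : ℕ → ℕ → ℕ
eb x y = ι (x ≡ᵇ y)

L-lb : ∀ {n} (i j : Fin n) → L i j ≡ lb (toℕ i) (toℕ j)
L-lb i j = cong ι (isYes≗does (i <? j))

eqb-toℕ : ∀ {n} (i j : Fin n) → eqb i j ≡ (toℕ i ≡ᵇ toℕ j)
eqb-toℕ i j = trans (isYes≗does (i ≟ j)) (does-≟ i j)
  where
  does-≟ : ∀ {n} (i j : Fin n) → does (i ≟ j) ≡ (toℕ i ≡ᵇ toℕ j)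
  does-≟ zero    zero    = refl
  does-≟ zero    (suc j) = refl
  does-≟ (suc i) zero    = refl
  does-≟ (suc i) (suc j) = does-≟ i j

eqb-eb : ∀ {n} (i j : Fin n) → ι (eqb i j) ≡ eb (toℕ i) (toℕ j)
eqb-eb i j = cong ι (eqb-toℕ i j)

trichotomy-ℕ : ∀ x y → lb y x + lb x y + eb x y ≡ 1
trichotomy-ℕ zero    zero    = refl
trichotomy-ℕ zero    (suc y) = refl
trichotomy-ℕ (suc x) zero    = refl
trichotomy-ℕ (suc x) (suc y) = trichotomy-ℕ x y

comparable-ℕ : ∀ x y → ¬ x ≡ y → lb y x + lb x y ≡ 1
comparable-ℕ zero    zero    ne = ⊥-elim (ne refl)
comparable-ℕ zero    (suc y) ne = refl
comparable-ℕ (suc x) zero    ne = refl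
comparable-ℕ (suc x) (suc y) ne = comparable-ℕ x y (λ e → ne (cong suc e))

position-ℕ : ∀ x a b → a < b → lb b x + lb x a + lb a x * lb x b + eb x a + eb x b ≡ 1
position-ℕ zero    zero    (suc b) p = refl
position-ℕ zero    (suc a) (suc b) p = refl
position-ℕ (suc x) zero    (suc b) p = trans (simplify (lb b x) (lb x b) (eb x b)) (trichotomy-ℕ x b)
  where
  simplify : ∀ u v w → u + 0 + 1 * v + 0 + w ≡ u + v + w
  simplify = solve-∀
position-ℕ (suc x) (suc a) (suc b) (s≤s p) = position-ℕ x a b p

between-ℕ : ∀ x a b → ¬ x ≡ a → ¬ x ≡ b → lb a b ≡ lb x a * lb a b + lb a x * lb x b + lb a b * lb b x
between-ℕ zero    zero    b       na nb = ⊥-elim (na refl)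
between-ℕ zero    (suc a) zero    na nb = ⊥-elim (nb refl)
between-ℕ zero    (suc a) (suc b) na nb = simplify (lb a b)
  where
  simplify : ∀ u → u ≡ 1 * u + 0 + u * 0
  simplify = solve-∀
between-ℕ (suc x) zero    zero    na nb = refl
between-ℕ (suc x) zero    (suc b) na nb =
  trans (sym (comparable-ℕ b x (λ e → nb (cong suc (sym e))))) (simplify (lb x b) (lb b x))
  where
  simplify : ∀ u v → u + v ≡ 0 * 1 + 1 * u + 1 * v
  simplify = solve-∀
between-ℕ (suc x) (suc a) zero    na nb = simplify (lb x a) (lb a x)
  where
  simplify : ∀ u v → 0 ≡ u * 0 + v * 0 + 0 * 1
  simplify = solve-∀
between-ℕ (suc x) (suc a) (suc b) na nb =
  between-ℕ x a b (λ e → na (cong suc e)) (λ e → nb (cong suc e))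

comparable : ∀ {n} (i j : Fin n) → ¬ i ≡ j → L i j + L j i ≡ 1
comparable i j ne rewrite L-lb i j | L-lb j i =
  comparable-ℕ (toℕ j) (toℕ i) (λ e → ne (toℕ-injective (sym e)))

position : ∀ {n} (x a b : Fin n) → lt a b ≡ true →
  L b x + L x a + L a x * L x b + ι (eqb x a) + ι (eqb x b) ≡ 1
position x a b p rewrite L-lb b x | L-lb x a | L-lb a x | L-lb x b | eqb-eb x a | eqb-eb x b =
  position-ℕ (toℕ x) (toℕ a) (toℕ b) (lt-sound p)

between : ∀ {n} (x a b : Fin n) → ¬ x ≡ a → ¬ x ≡ b →
  L a b ≡ L x a * L a b + L a x * L x b + L a b * L b x
between x a b na nb rewrite L-lb a b | L-lb x a | L-lb a x | L-lb x b | L-lb b x =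
  between-ℕ (toℕ x) (toℕ a) (toℕ b) (λ e → na (toℕ-injective e)) (λ e → nb (toℕ-injective e))

eqb-injective : ∀ {m n} (f : Fin m → Fin n) → (∀ {x y} → f x ≡ f y → x ≡ y) → ∀ i j → eqb (f i) (f j) ≡ eqb i j
eqb-injective f inj i j with i ≟ j
... | yes refl = eqb-true refl
... | no ne    = eqb-false (λ q → ne (inj q))

sumF-δ : ∀ {n} (g : Fin n → ℕ) (a : Fin n) → sumF (λ w → ι (eqb w a) * g w) ≡ g a
sumF-δ {suc n} g zero    = trans (cong (g zero + 0 +_) (sumF-0 {n})) (trans (+-identityʳ _) (+-identityʳ _))
sumF-δ {suc n} g (suc a) =
  trans (sumF-cong (λ i → cong (λ b → ι b * g (suc i)) (eqb-injective suc Fin-suc-injective i a))) (sumF-δ (λ i → g (suc i)) a)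

sumF-eqb : ∀ {n} (a : Fin n) → sumF (λ w → ι (eqb w a)) ≡ 1
sumF-eqb a = trans (sumF-cong (λ w → sym (*-identityʳ (ι (eqb w a))))) (sumF-δ (λ _ → 1) a)

sumF-≥2 : ∀ {n} (f : Fin n → ℕ) j k → ¬ j ≡ k → f j + f k ≤ sumF f
sumF-≥2 f j k ne = begin
    f j + f k
  ≡⟨ sym (cong₂ _+_ (sumF-δ f j) (sumF-δ f k)) ⟩
    sumF (λ w → ι (eqb w j) * f w) + sumF (λ w → ι (eqb w k) * f w)
  ≡⟨ sym (sumF-+ (λ w → ι (eqb w j) * f w) (λ w → ι (eqb w k) * f w)) ⟩
    sumF (λ w → ι (eqb w j) * f w + ι (eqb w k) * f w)
  ≤⟨ sumF-mono termwise ⟩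
    sumF f ∎
  where
  open ≤-Reasoning
  termwise : ∀ w → ι (eqb w j) * f w + ι (eqb w k) * f w ≤ f w
  termwise w with w ≟ j | w ≟ k
  ... | yes refl | yes refl = ⊥-elim (ne refl)
  ... | yes refl | no _     = ≤-reflexive (trans (+-identityʳ _) (+-identityʳ _))
  ... | no _     | yes refl = ≤-reflexive (+-identityʳ _)
  ... | no _     | no _     = z≤n

-- Graphs: edge indicators, the handshake lemma and complements

E : ∀ {n} → Graph n → Fin n → Fin n → ℕ
E X i j = ι (adj X i j)

E-sym : ∀ {n} (X : Graph n) i j → E X i j ≡ E X j i
E-sym X i j = cong ι (adj-sym X i j)

E-irr : ∀ {n} (X : Graph n) i → E X i i ≡ 0
E-irr X i = cong ι (adj-irrefl X i)

adj⇒≢ : ∀ {n} (X : Graph n) {a b} → adj X a b ≡ true → ¬ a ≡ b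
adj⇒≢ X {a} h refl with trans (sym h) (adj-irrefl X a)
... | ()

degree1-unique : ∀ {n} (X : Graph n) v {a b} → degree X v ≡ 1 → adj X v a ≡ true → adj X v b ≡ true → a ≡ b
degree1-unique X v {a} {b} d ea eb with a ≟ b
... | yes q  = q
... | no ne = ⊥-elim (<-irrefl (sym d)
  (subst₂ (λ x y → x + y ≤ degree X v) (cong ι ea) (cong ι eb) (sumF-≥2 (E X v) a b ne)))

sumF-symmetric : ∀ {n} (h : Fin n → Fin n → ℕ) → (∀ i j → h i j ≡ h j i) → (∀ i → h i i ≡ 0) →
  sumF (λ i → sumF (λ j → h i j)) ≡ 2 * sumF (λ i → sumF (λ j → L i j * h i j))
sumF-symmetric h h-sym h-diag = begin
    sumF (λ i → sumF (λ j → h i j))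
  ≡⟨ sumF-cong (λ i → sumF-cong (λ j → split i j)) ⟩
    sumF (λ i → sumF (λ j → L i j * h i j + L j i * h j i))
  ≡⟨ sumF-cong (λ i → sumF-+ (λ j → L i j * h i j) (λ j → L j i * h j i)) ⟩
    sumF (λ i → upper i + sumF (λ j → L j i * h j i))
  ≡⟨ sumF-+ upper (λ i → sumF (λ j → L j i * h j i)) ⟩
    sumF upper + sumF (λ i → sumF (λ j → L j i * h j i))
  ≡⟨ cong (sumF upper +_) (sumF-swap (λ i j → L j i * h j i)) ⟩
    sumF upper + sumF upper
  ≡⟨ cong (sumF upper +_) (sym (+-identityʳ _)) ⟩
    2 * sumF upper ∎
  where
  open ≡-Reasoning
  upper : Fin _ → ℕ
  upper i = sumF (λ j → L i j * h i j)
  split : ∀ i j → h i j ≡ L i j * h i j + L j i * h j i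
  split i j with i ≟ j
  ... | yes refl rewrite L-irr i | h-diag i = refl
  ... | no ne rewrite sym (h-sym i j) =
    trans (sym (*-identityˡ (h i j)))
      (trans (cong (_* h i j) (sym (comparable i j ne))) (*-distribʳ-+ (h i j) (L i j) (L j i)))

size-E : ∀ {n} (X : Graph n) → size X ≡ sumF (λ i → sumF (λ j → L i j * E X i j))
size-E X = sumF-cong (λ i → sumF-cong (λ j → ι-∧ (lt i j) (adj X i j)))

handshake : ∀ {n} (X : Graph n) → sumF (degree X) ≡ 2 * size X
handshake X = trans (sumF-symmetric (E X) (E-sym X) (E-irr X)) (cong (2 *_) (sym (size-E X)))

IsComplementOf : ∀ {n} → Graph n → Graph n → Set
IsComplementOf Y X = ∀ i j → adj Y i j ≡ (neq i j ∧ not (adj X i j))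

complement-is : ∀ {n} (X : Graph n) → IsComplementOf (complement X) X
complement-is X i j rewrite adj-sym X j i with adj X i j
... | true  = refl
... | false = refl

complement-is′ : ∀ {n} (X : Graph n) → IsComplementOf X (complement X)
complement-is′ X i j rewrite complement-is X i j with i ≟ j
... | yes refl rewrite adj-irrefl X i = refl
... | no _ with adj X i j
... | true  = refl
... | false = refl

complement-pair : ∀ {n} {Y X : Graph n} → IsComplementOf Y X → ∀ i j → E Y i j + E X i j + ι (eqb i j) ≡ 1
complement-pair {Y = Y} {X} c i j rewrite c i j with i ≟ j
... | yes refl rewrite adj-irrefl X i = refl
... | no _ with adj X i j
... | true  = refl
... | false = refl

complement-degree : ∀ {n} {Y X : Graph n} → IsComplementOf Y X → ∀ v → degree Y v + degree X v + 1 ≡ n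
complement-degree {n} {Y} {X} c v = begin
    degree Y v + degree X v + 1
  ≡⟨ cong (degree Y v + degree X v +_) (sym (sumF-eqb v)) ⟩
    degree Y v + degree X v + sumF (λ w → ι (eqb w v))
  ≡⟨ cong (_+ sumF (λ w → ι (eqb w v))) (sym (sumF-+ (E Y v) (E X v))) ⟩
    sumF (λ w → E Y v w + E X v w) + sumF (λ w → ι (eqb w v))
  ≡⟨ sym (sumF-+ (λ w → E Y v w + E X v w) (λ w → ι (eqb w v))) ⟩
    sumF (λ w → E Y v w + E X v w + ι (eqb w v))
  ≡⟨ sumF-cong (λ w → trans (cong (E Y v w + E X v w +_) (cong ι (eqb-sym w v))) (complement-pair {Y = Y} {X} c v w)) ⟩
    sumF {n} (λ _ → 1)
  ≡⟨ sumF-1 ⟩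
    n ∎
  where open ≡-Reasoning

C2-suc : ∀ a → suc a C 2 ≡ a + a C 2
C2-suc a = trans (sym (nCk+nC[k+1]≡[n+1]C[k+1] a 1)) (cong (_+ a C 2) (nC1≡n a))

pairs-count : ∀ n → sumF {n} (λ i → sumF {n} (λ j → L i j)) ≡ n C 2
pairs-count zero    = refl
pairs-count (suc n) =
  trans (cong₂ _+_ (sumF-1 {n}) (trans (sumF-cong {n} (λ i → sumF-cong {n} (λ j → L-suc i j))) (pairs-count n)))
        (sym (C2-suc n))

complement-size : ∀ {n} {Y X : Graph n} → IsComplementOf Y X → size Y + size X ≡ n C 2
complement-size {n} {Y} {X} c = begin
    size Y + size X
  ≡⟨ cong₂ _+_ (size-E Y) (size-E X) ⟩
    sumF (λ i → sumF (λ j → L i j * E Y i j)) + sumF (λ i → sumF (λ j → L i j * E X i j))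
  ≡⟨ sym (sumF-+ (λ i → sumF (λ j → L i j * E Y i j)) (λ i → sumF (λ j → L i j * E X i j))) ⟩
    sumF (λ i → sumF (λ j → L i j * E Y i j) + sumF (λ j → L i j * E X i j))
  ≡⟨ sumF-cong (λ i → sym (sumF-+ (λ j → L i j * E Y i j) (λ j → L i j * E X i j))) ⟩
    sumF (λ i → sumF (λ j → L i j * E Y i j + L i j * E X i j))
  ≡⟨ sumF-cong (λ i → sumF-cong (λ j → ordered-pair i j)) ⟩
    sumF {n} (λ i → sumF (λ j → L i j))
  ≡⟨ pairs-count n ⟩
    n C 2 ∎
  where
  open ≡-Reasoning
  ordered-pair : ∀ i j → L i j * E Y i j + L i j * E X i j ≡ L i j
  ordered-pair i j with lt i j in e
  ... | false = refl
  ... | true  = begin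
      1 * E Y i j + 1 * E X i j
    ≡⟨ cong₂ _+_ (*-identityˡ (E Y i j)) (*-identityˡ (E X i j)) ⟩
      E Y i j + E X i j
    ≡⟨ sym (+-identityʳ _) ⟩
      E Y i j + E X i j + ι false
    ≡⟨ cong (λ b → E Y i j + E X i j + ι b) (sym (eqb-false (lt⇒≢ e))) ⟩
      E Y i j + E X i j + ι (eqb i j)
    ≡⟨ complement-pair {Y = Y} {X} c i j ⟩
      1 ∎

sum3 : ∀ {n} → (Fin n → Fin n → Fin n → ℕ) → ℕ
sum3 F = sumF (λ i → sumF (λ j → sumF (λ k → F i j k)))

sum3-cong : ∀ {n} {F G : Fin n → Fin n → Fin n → ℕ} → (∀ i j k → F i j k ≡ G i j k) → sum3 F ≡ sum3 G
sum3-cong e = sumF-cong (λ i → sumF-cong (λ j → sumF-cong (λ k → e i j k)))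

sum3-+ : ∀ {n} (F G : Fin n → Fin n → Fin n → ℕ) → sum3 (λ i j k → F i j k + G i j k) ≡ sum3 F + sum3 G
sum3-+ F G =
  trans (sumF-cong (λ i → trans (sumF-cong (λ j → sumF-+ (F i j) (G i j)))
                                (sumF-+ (λ j → sumF (F i j)) (λ j → sumF (G i j)))))
        (sumF-+ (λ i → sumF (λ j → sumF (F i j))) (λ i → sumF (λ j → sumF (G i j))))

-- The weight [i < j][j < k] · x: summing it over all i, j, k sums x over the
-- triples i < j < k.
ordered : ∀ {n} → Fin n → Fin n → Fin n → ℕ → ℕ
ordered i j k x = L i j * (L j k * x)

triples : ℕ → ℕ
triples n = sum3 {n} (λ i j k → ordered i j k 1)

edgesInTriples : ∀ {n} → Graph n → ℕ
edgesInTriples X = sum3 (λ i j k → ordered i j k (E X i j + E X j k + E X i k))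

cherriesInTriples : ∀ {n} → Graph n → ℕ
cherriesInTriples X =
  sum3 (λ i j k → ordered i j k (E X i j * E X j k + E X i j * E X i k + E X i k * E X j k))

triangles-sum3 : ∀ {n} (X : Graph n) → triangles X ≡ sum3 (λ i j k → ordered i j k (ι (adj X i j ∧ adj X j k ∧ adj X i k)))
triangles-sum3 X = sum3-cong (λ i j k →
  trans (ι-∧ (lt i j) (lt j k ∧ adj X i j ∧ adj X j k ∧ adj X i k))
        (cong (L i j *_) (ι-∧ (lt j k) (adj X i j ∧ adj X j k ∧ adj X i k))))

complement-adj : ∀ {n} {Y X : Graph n} → IsComplementOf Y X → ∀ {i j} → ¬ i ≡ j → adj Y i j ≡ not (adj X i j)
complement-adj c {i} {j} ne rewrite c i j | eqb-false ne = refl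

goodman-triple : ∀ a b c → ι (not a ∧ not b ∧ not c) + ι (a ∧ b ∧ c) + (ι a + ι b + ι c)
                           ≡ 1 + (ι a * ι b + ι a * ι c + ι c * ι b)
goodman-triple true  true  true  = refl
goodman-triple true  true  false = refl
goodman-triple true  false true  = refl
goodman-triple true  false false = refl
goodman-triple false true  true  = refl
goodman-triple false true  false = refl
goodman-triple false false true  = refl
goodman-triple false false false = refl

goodman : ∀ {n} {Y X : Graph n} → IsComplementOf Y X →
  triangles Y + triangles X + edgesInTriples X ≡ triples n + cherriesInTriples X
goodman {n} {Y} {X} c = begin
    triangles Y + triangles X + edgesInTriples X
  ≡⟨ cong₂ (λ a b → a + b + edgesInTriples X) (triangles-sum3 Y) (triangles-sum3 X) ⟩
    sum3 (tri Y) + sum3 (tri X) + edgesInTriples X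
  ≡⟨ cong (_+ edgesInTriples X) (sym (sum3-+ (tri Y) (tri X))) ⟩
    sum3 (λ i j k → tri Y i j k + tri X i j k) + edgesInTriples X
  ≡⟨ sym (sum3-+ (λ i j k → tri Y i j k + tri X i j k) (λ i j k → ordered i j k (e i j k))) ⟩
    sum3 (λ i j k → tri Y i j k + tri X i j k + ordered i j k (e i j k))
  ≡⟨ sum3-cong per-triple ⟩
    sum3 (λ i j k → ordered i j k 1 + ordered i j k (p i j k))
  ≡⟨ sum3-+ (λ i j k → ordered i j k 1) (λ i j k → ordered i j k (p i j k)) ⟩
    triples n + cherriesInTriples X ∎
  where
  open ≡-Reasoning
  tri : Graph n → Fin n → Fin n → Fin n → ℕ
  tri Z i j k = ordered i j k (ι (adj Z i j ∧ adj Z j k ∧ adj Z i k))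
  e p : Fin n → Fin n → Fin n → ℕ
  e i j k = E X i j + E X j k + E X i k
  p i j k = E X i j * E X j k + E X i j * E X i k + E X i k * E X j k
  per-triple : ∀ i j k → tri Y i j k + tri X i j k + ordered i j k (e i j k) ≡ ordered i j k 1 + ordered i j k (p i j k)
  per-triple i j k with lt i j in e₁ | lt j k in e₂
  ... | false | _     = refl
  ... | true  | false = refl
  ... | true  | true  = begin
      1 * (1 * tY) + 1 * (1 * tX) + 1 * (1 * e i j k)
    ≡⟨ unit (tY) (tX) (e i j k) ⟩
      tY + tX + e i j k
    ≡⟨ cong (λ z → ι z + tX + e i j k)
         (cong₂ _∧_ (complement-adj {Y = Y} {X} c ne-ij) (cong₂ _∧_ (complement-adj {Y = Y} {X} c ne-jk) (complement-adj {Y = Y} {X} c ne-ik))) ⟩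
      ι (not (adj X i j) ∧ not (adj X j k) ∧ not (adj X i k)) + tX + e i j k
    ≡⟨ goodman-triple (adj X i j) (adj X j k) (adj X i k) ⟩
      1 + p i j k
    ≡⟨ sym (unit′ (p i j k)) ⟩
      1 * (1 * 1) + 1 * (1 * p i j k) ∎
    where
    tY = ι (adj Y i j ∧ adj Y j k ∧ adj Y i k)
    tX = ι (adj X i j ∧ adj X j k ∧ adj X i k)
    unit : ∀ a b c → 1 * (1 * a) + 1 * (1 * b) + 1 * (1 * c) ≡ a + b + c
    unit = solve-∀
    unit′ : ∀ a → 1 * (1 * 1) + 1 * (1 * a) ≡ 1 + a
    unit′ = solve-∀
    ne-ij : ¬ i ≡ j
    ne-ij = lt⇒≢ e₁
    ne-jk : ¬ j ≡ k
    ne-jk = lt⇒≢ e₂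
    ne-ik : ¬ i ≡ k
    ne-ik = lt⇒≢ (lt-true (<-trans (lt-sound e₁) (lt-sound e₂)))

-- Each edge ab lies in exactly n − 2 triples:  Σ_triples #X-edges + 2 e(X) = n e(X).
module EdgesInTriples {n : ℕ} (X : Graph n) where

  V : Fin n → Fin n → ℕ
  V a b = L a b * E X a b

  overEdges : (Fin n → Fin n → ℕ) → ℕ
  overEdges A = sumF (λ a → sumF (λ b → V a b * A a b))

  -- For an edge a < b, the third vertex k lies above b, below a, or between them.
  above below inside : Fin n → Fin n → ℕ
  above a b  = sumF (λ k → L b k)
  below a b  = sumF (λ k → L k a)
  inside a b = sumF (λ k → L a k * L k b)

  edge-ij edge-jk edge-ik : ℕ
  edge-ij = sum3 (λ i j k → ordered i j k (E X i j))
  edge-jk = sum3 (λ i j k → ordered i j k (E X j k))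
  edge-ik = sum3 (λ i j k → ordered i j k (E X i k))

  split-positions : edgesInTriples X ≡ edge-ij + edge-jk + edge-ik
  split-positions =
    trans (sum3-cong (λ i j k → distrib (L i j) (L j k) (E X i j) (E X j k) (E X i k)))
      (trans (sum3-+ (λ i j k → ordered i j k (E X i j) + ordered i j k (E X j k)) (λ i j k → ordered i j k (E X i k)))
             (cong (_+ edge-ik) (sum3-+ (λ i j k → ordered i j k (E X i j)) (λ i j k → ordered i j k (E X j k)))))
    where
    distrib : ∀ a b x y z → a * (b * (x + y + z)) ≡ a * (b * x) + a * (b * y) + a * (b * z)
    distrib = solve-∀

  edge-ij≡ : edge-ij ≡ overEdges above
  edge-ij≡ = sumF-cong (λ a → sumF-cong (λ b →
    trans (sumF-cong (λ k → reorder (L a b) (L b k) (E X a b))) (sumF-*ˡ (V a b) (λ k → L b k))))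
    where
    reorder : ∀ x y z → x * (y * z) ≡ x * z * y
    reorder = solve-∀

  edge-jk≡ : edge-jk ≡ overEdges below
  edge-jk≡ = trans (sumF-swap (λ i j → sumF (λ k → ordered i j k (E X j k))))
    (sumF-cong (λ j → trans (sumF-swap (λ i k → ordered i j k (E X j k)))
      (sumF-cong (λ k → trans (sumF-cong (λ i → reorder (L i j) (L j k) (E X j k))) (sumF-*ˡ (V j k) (λ i → L i j))))))
    where
    reorder : ∀ x y z → x * (y * z) ≡ y * z * x
    reorder = solve-∀

  edge-ik≡ : edge-ik ≡ overEdges inside
  edge-ik≡ = sumF-cong (λ i → trans (sumF-swap (λ j k → ordered i j k (E X i k)))
    (sumF-cong (λ k → trans (sumF-cong (λ j → term i j k)) (sumF-*ˡ (V i k) (λ j → L i j * L j k)))))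
    where
    reassoc : ∀ x y z → x * (y * z) ≡ x * y * z
    reassoc = solve-∀
    reorder : ∀ x y z w → x * y * w * z ≡ w * z * (x * y)
    reorder = solve-∀
    term : ∀ i j k → ordered i j k (E X i k) ≡ V i k * (L i j * L j k)
    term i j k = trans (reassoc (L i j) (L j k) (E X i k))
      (trans (cong (_* E X i k) (sym (L-trans i j k))) (reorder (L i j) (L j k) (E X i k) (L i k)))

  positions : ∀ a b → lt a b ≡ true → above a b + below a b + inside a b + 1 + 1 ≡ n
  positions a b p = begin
      above a b + below a b + inside a b + 1 + 1
    ≡⟨ cong₂ (λ x y → above a b + below a b + inside a b + x + y) (sym (sumF-eqb a)) (sym (sumF-eqb b)) ⟩
      above a b + below a b + inside a b + sumF (λ k → ι (eqb k a)) + sumF (λ k → ι (eqb k b))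
    ≡⟨ cong (λ x → x + sumF (λ k → ι (eqb k a)) + sumF (λ k → ι (eqb k b)))
         (sym (trans (sumF-+ (λ k → L b k + L k a) (λ k → L a k * L k b)) (cong (_+ inside a b) (sumF-+ (λ k → L b k) (λ k → L k a))))) ⟩
      sumF (λ k → L b k + L k a + L a k * L k b) + sumF (λ k → ι (eqb k a)) + sumF (λ k → ι (eqb k b))
    ≡⟨ cong (_+ sumF (λ k → ι (eqb k b))) (sym (sumF-+ (λ k → L b k + L k a + L a k * L k b) (λ k → ι (eqb k a)))) ⟩
      sumF (λ k → L b k + L k a + L a k * L k b + ι (eqb k a)) + sumF (λ k → ι (eqb k b))
    ≡⟨ sym (sumF-+ (λ k → L b k + L k a + L a k * L k b + ι (eqb k a)) (λ k → ι (eqb k b))) ⟩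
      sumF (λ k → L b k + L k a + L a k * L k b + ι (eqb k a) + ι (eqb k b))
    ≡⟨ sumF-cong (λ k → position k a b p) ⟩
      sumF {n} (λ _ → 1)
    ≡⟨ sumF-1 ⟩
      n ∎
    where open ≡-Reasoning

  per-edge : ∀ a b → V a b * above a b + V a b * below a b + V a b * inside a b + 2 * V a b ≡ n * V a b
  per-edge a b = trans (collect (V a b) (above a b) (below a b) (inside a b)) (by-order (lt a b) refl)
    where
    collect : ∀ v x y z → v * x + v * y + v * z + 2 * v ≡ (x + y + z + 1 + 1) * v
    collect = solve-∀
    by-order : (t : Bool) → lt a b ≡ t → (above a b + below a b + inside a b + 1 + 1) * V a b ≡ n * V a b
    by-order false e rewrite e = trans (*-zeroʳ (above a b + below a b + inside a b + 1 + 1)) (sym (*-zeroʳ n))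
    by-order true  e = cong (_* V a b) (positions a b e)

  edges-in-triples : edgesInTriples X + 2 * size X ≡ n * size X
  edges-in-triples = begin
      edgesInTriples X + 2 * size X
    ≡⟨ cong₂ _+_ (trans split-positions (cong₂ _+_ (cong₂ _+_ edge-ij≡ edge-jk≡) edge-ik≡)) (cong (2 *_) (size-E X)) ⟩
      overEdges above + overEdges below + overEdges inside + 2 * sumF (λ a → sumF (V a))
    ≡⟨ cong (overEdges above + overEdges below + overEdges inside +_)
         (sym (trans (sumF-cong (λ a → sumF-*ˡ 2 (V a))) (sumF-*ˡ 2 (λ a → sumF (V a))))) ⟩
      overEdges above + overEdges below + overEdges inside + sumF (λ a → sumF (λ b → 2 * V a b))
    ≡⟨ sym (linear f₁ f₂ f₃ f₄) ⟩
      sumF (λ a → sumF (λ b → f₁ a b + f₂ a b + f₃ a b + f₄ a b))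
    ≡⟨ sumF-cong (λ a → sumF-cong (λ b → per-edge a b)) ⟩
      sumF (λ a → sumF (λ b → n * V a b))
    ≡⟨ trans (sumF-cong (λ a → sumF-*ˡ n (V a))) (sumF-*ˡ n (λ a → sumF (V a))) ⟩
      n * sumF (λ a → sumF (V a))
    ≡⟨ cong (n *_) (sym (size-E X)) ⟩
      n * size X ∎
    where
    open ≡-Reasoning
    f₁ f₂ f₃ f₄ : Fin n → Fin n → ℕ
    f₁ a b = V a b * above a b
    f₂ a b = V a b * below a b
    f₃ a b = V a b * inside a b
    f₄ a b = 2 * V a b
    sum2 : (Fin n → Fin n → ℕ) → ℕ
    sum2 f = sumF (λ a → sumF (f a))
    sum2-+ : ∀ f g → sum2 (λ a b → f a b + g a b) ≡ sum2 f + sum2 g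
    sum2-+ f g = trans (sumF-cong (λ a → sumF-+ (f a) (g a))) (sumF-+ (λ a → sumF (f a)) (λ a → sumF (g a)))
    linear : ∀ f g h k → sum2 (λ a b → f a b + g a b + h a b + k a b) ≡ sum2 f + sum2 g + sum2 h + sum2 k
    linear f g h k =
      trans (sum2-+ (λ a b → f a b + g a b + h a b) k)
        (cong (_+ sum2 k) (trans (sum2-+ (λ a b → f a b + g a b) h) (cong (_+ sum2 h) (sum2-+ f g))))

open EdgesInTriples using (edges-in-triples)

-- Pairs of neighbours and the convexity identity

pairs : ∀ {n} → (Fin n → ℕ) → ℕ
pairs f = sumF (λ a → sumF (λ b → L a b * (f a * f b)))

pairs-suc : ∀ {n} (f : Fin (suc n) → ℕ) → pairs f ≡ f zero * sumF (λ i → f (suc i)) + pairs (λ i → f (suc i))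
pairs-suc f = cong₂ _+_
  (trans (sumF-cong (λ b → *-identityˡ (f zero * f (suc b)))) (sumF-*ˡ (f zero) (λ b → f (suc b))))
  (sumF-cong (λ a → sumF-cong (λ b → cong (_* (f (suc a) * f (suc b))) (L-suc a b))))

C2-+ : ∀ a b → (a + b) C 2 ≡ a C 2 + b C 2 + a * b
C2-+ zero    b = sym (+-identityʳ (b C 2))
C2-+ (suc a) b = begin
    suc (a + b) C 2
  ≡⟨ C2-suc (a + b) ⟩
    a + b + (a + b) C 2
  ≡⟨ cong (a + b +_) (C2-+ a b) ⟩
    a + b + (a C 2 + b C 2 + a * b)
  ≡⟨ regroup a b (a C 2) (b C 2) ⟩
    a + a C 2 + b C 2 + suc a * b
  ≡⟨ cong (λ z → z + b C 2 + suc a * b) (sym (C2-suc a)) ⟩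
    suc a C 2 + b C 2 + suc a * b ∎
  where
  open ≡-Reasoning
  regroup : ∀ a b x y → a + b + (x + y + a * b) ≡ a + x + y + (b + a * b)
  regroup = solve-∀

C2-sum : ∀ {n} (f : Fin n → ℕ) → (sumF f) C 2 ≡ sumF (λ v → f v C 2) + pairs f
C2-sum {zero}  f = refl
C2-sum {suc n} f = begin
    (f zero + S) C 2
  ≡⟨ C2-+ (f zero) S ⟩
    f zero C 2 + S C 2 + f zero * S
  ≡⟨ cong (λ z → f zero C 2 + z + f zero * S) (C2-sum (λ i → f (suc i))) ⟩
    f zero C 2 + (sumF (λ v → f (suc v) C 2) + pairs (λ i → f (suc i))) + f zero * S
  ≡⟨ regroup (f zero C 2) (sumF (λ v → f (suc v) C 2)) (pairs (λ i → f (suc i))) (f zero * S) ⟩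
    f zero C 2 + sumF (λ v → f (suc v) C 2) + (f zero * S + pairs (λ i → f (suc i)))
  ≡⟨ cong (f zero C 2 + sumF (λ v → f (suc v) C 2) +_) (sym (pairs-suc f)) ⟩
    f zero C 2 + sumF (λ v → f (suc v) C 2) + pairs f ∎
  where
  open ≡-Reasoning
  S = sumF (λ i → f (suc i))
  regroup : ∀ a b c d → a + (b + c) + d ≡ a + b + (d + c)
  regroup = solve-∀

degree-C2 : ∀ {n} (X : Graph n) v → degree X v C 2 ≡ pairs (E X v)
degree-C2 {n} X v =
  trans (C2-sum (E X v)) (cong (_+ pairs (E X v)) (trans (sumF-cong {n} (λ u → ι-C2 (adj X v u))) (sumF-0 {n})))
  where
  ι-C2 : ∀ b → ι b C 2 ≡ 0
  ι-C2 true  = refl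
  ι-C2 false = refl

convexity : ∀ {n} (g : Fin n → ℕ) → sumF (λ v → suc (g v) C 2) + pairs g ≡ suc (sumF g) C 2
convexity g = begin
    sumF (λ v → suc (g v) C 2) + pairs g
  ≡⟨ cong (_+ pairs g) (trans (sumF-cong (λ v → C2-suc (g v))) (sumF-+ g (λ v → g v C 2))) ⟩
    sumF g + sumF (λ v → g v C 2) + pairs g
  ≡⟨ +-assoc (sumF g) _ _ ⟩
    sumF g + (sumF (λ v → g v C 2) + pairs g)
  ≡⟨ cong (sumF g +_) (sym (C2-sum g)) ⟩
    sumF g + sumF g C 2
  ≡⟨ sym (C2-suc (sumF g)) ⟩
    suc (sumF g) C 2 ∎
  where open ≡-Reasoning

-- A pair of neighbours a, b of v, together with v, forms a triple in exactly
-- one of the orders v < a < b, a < v < b, a < b < v.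
cherry-position : ∀ {n} (v a b : Fin n) (x y : Bool) → (x ≡ true → ¬ v ≡ a) → (y ≡ true → ¬ v ≡ b) →
  L a b * (ι x * ι y) ≡ L v a * (L a b * (ι x * ι y)) + L a v * (L v b * (ι x * ι y)) + L a b * (L b v * (ι x * ι y))
cherry-position v a b false y _ _ = absorb (L a b) (L v a) (L a v) (L v b) (L b v)
  where
  absorb : ∀ p q r s t → p * 0 ≡ q * (p * 0) + r * (s * 0) + p * (t * 0)
  absorb = solve-∀
cherry-position v a b true false _ _ = absorb (L a b) (L v a) (L a v) (L v b) (L b v)
  where
  absorb : ∀ p q r s t → p * 0 ≡ q * (p * 0) + r * (s * 0) + p * (t * 0)
  absorb = solve-∀
cherry-position v a b true true na nb =
  trans (*-identityʳ (L a b)) (trans (between v a b (na refl) (nb refl)) (unit (L v a) (L a b) (L a v) (L v b) (L b v)))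
  where
  unit : ∀ p q r s t → p * q + r * s + q * t ≡ p * (q * 1) + r * (s * 1) + q * (t * 1)
  unit = solve-∀

cherries : ∀ {n} (X : Graph n) → cherriesInTriples X ≡ sumF (λ v → degree X v C 2)
cherries {n} X = begin
    cherriesInTriples X
  ≡⟨ sum3-cong (λ i j k → distrib (L i j) (L j k) (E X i j) (E X j k) (E X i k)) ⟩
    sum3 (λ i j k → centre-j i j k + centre-i i j k + centre-k i j k)
  ≡⟨ trans (sum3-+ (λ i j k → centre-j i j k + centre-i i j k) centre-k) (cong (_+ sum3 centre-k) (sum3-+ centre-j centre-i)) ⟩
    sum3 centre-j + sum3 centre-i + sum3 centre-k
  ≡⟨ cong₂ (λ x y → x + sum3 centre-i + y) (sumF-swap (λ a v → sumF (centre-j a v)))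
       (trans (sumF-cong (λ a → sumF-swap (λ b v → centre-k a b v))) (sumF-swap (λ a v → sumF (λ b → centre-k a b v)))) ⟩
    sum3 (λ v a b → centre-j a v b) + sum3 centre-i + sum3 (λ v a b → centre-k a b v)
  ≡⟨ sym (trans (sum3-+ (λ v a b → centre-i v a b + centre-j a v b) (λ v a b → centre-k a b v))
        (cong (_+ sum3 (λ v a b → centre-k a b v)) (trans (sum3-+ centre-i (λ v a b → centre-j a v b)) (+-comm (sum3 centre-i) _)))) ⟩
    sum3 (λ v a b → centre-i v a b + centre-j a v b + centre-k a b v)
  ≡⟨ sym (sum3-cong at-centre) ⟩
    sumF (λ v → pairs (E X v))
  ≡⟨ sumF-cong (λ v → sym (degree-C2 X v)) ⟩
    sumF (λ v → degree X v C 2) ∎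
  where
  open ≡-Reasoning
  centre-j centre-i centre-k : Fin n → Fin n → Fin n → ℕ
  centre-j i j k = ordered i j k (E X i j * E X j k)
  centre-i i j k = ordered i j k (E X i j * E X i k)
  centre-k i j k = ordered i j k (E X i k * E X j k)
  distrib : ∀ x y a b c → x * (y * (a * b + a * c + c * b)) ≡ x * (y * (a * b)) + x * (y * (a * c)) + x * (y * (c * b))
  distrib = solve-∀
  at-centre : ∀ v a b → L a b * (E X v a * E X v b) ≡ centre-i v a b + centre-j a v b + centre-k a b v
  at-centre v a b rewrite E-sym X a v | E-sym X b v =
    cherry-position v a b (adj X v a) (adj X v b) (adj⇒≢ X) (adj⇒≢ X)

-- The balance identity

NoIsolatedVertex : ∀ {n} → Graph n → Set
NoIsolatedVertex X = ∀ v → 1 ≤ degree X v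

excess : ∀ {n} → Graph n → Fin n → ℕ
excess X v = degree X v ∸ 1

suc-excess : ∀ {n} {X : Graph n} → NoIsolatedVertex X → ∀ v → suc (excess X v) ≡ degree X v
suc-excess d v = suc-∸1 (d v)
  where
  suc-∸1 : ∀ {m} → 1 ≤ m → suc (m ∸ 1) ≡ m
  suc-∸1 {suc m} _ = refl

excess-sum : ∀ {n} (X : Graph n) → NoIsolatedVertex X → n + sumF (excess X) ≡ 2 * size X
excess-sum {n} X d =
  trans (cong (_+ sumF (excess X)) (sym (sumF-1 {n})))
        (trans (sym (sumF-+ (λ _ → 1) (excess X))) (trans (sumF-cong (suc-excess {X = X} d)) (handshake X)))

pairs-zero< : ∀ {n} (f : Fin n → ℕ) → pairs f ≡ 0 → ∀ a b → toℕ a < toℕ b → f a * f b ≡ 0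
pairs-zero< f e a b p =
  trans (sym (*-identityˡ (f a * f b)))
    (trans (cong (λ t → ι t * (f a * f b)) (sym (lt-true p)))
      (sumF-≡0 (λ b → L a b * (f a * f b)) (sumF-≡0 (λ a → sumF (λ b → L a b * (f a * f b))) e a) b))

pairs-zero : ∀ {n} (f : Fin n → ℕ) → pairs f ≡ 0 → ∀ a b → ¬ a ≡ b → f a * f b ≡ 0
pairs-zero f e a b ne with Finₚ.<-cmp a b
... | tri< p _ _ = pairs-zero< f e a b p
... | tri≈ _ q _ = ⊥-elim (ne q)
... | tri> _ _ p = trans (*-comm (f a) (f b)) (pairs-zero< f e b a p)

two-neighbours : ∀ {n} (X : Graph n) {a b c} → adj X a b ≡ true → adj X a c ≡ true → ¬ b ≡ c → 1 ≤ excess X a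
two-neighbours X {a} {b} {c} ab ac b≢c =
  ∸-monoˡ-≤ 1 (subst₂ (λ x y → x + y ≤ degree X a) (cong ι ab) (cong ι ac) (sumF-≥2 (E X a) b c b≢c))

-- If at most one vertex has degree ≥ 2 (all products of excesses vanish), there
-- is no triangle: two corners of a triangle would both have positive excess.
triangle-free : ∀ {n} (X : Graph n) → pairs (excess X) ≡ 0 → triangles X ≡ 0
triangle-free {n} X e = trans (triangles-sum3 X) (trans (sum3-cong no-triangle) sum3-0)
  where
  sum3-0 : sum3 {n} (λ _ _ _ → 0) ≡ 0
  sum3-0 = trans (sumF-cong {n} (λ i → trans (sumF-cong {n} (λ j → sumF-0 {n})) (sumF-0 {n}))) (sumF-0 {n})
  vanish : ∀ x y → x * (y * 0) ≡ 0
  vanish = solve-∀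
  positive : ∀ {x y} → 1 ≤ x → 1 ≤ y → ¬ x * y ≡ 0
  positive {suc x} {suc y} _ _ ()
  no-triangle : ∀ i j k → ordered i j k (ι (adj X i j ∧ adj X j k ∧ adj X i k)) ≡ 0
  no-triangle i j k with adj X i j in e₁ | adj X j k in e₂ | adj X i k in e₃
  ... | false | _     | _     = vanish (L i j) (L j k)
  ... | true  | false | _     = vanish (L i j) (L j k)
  ... | true  | true  | false = vanish (L i j) (L j k)
  ... | true  | true  | true  = ⊥-elim (positive excess-i excess-j (pairs-zero (excess X) e i j (adj⇒≢ X e₁)))
    where
    excess-i : 1 ≤ excess X i
    excess-i = two-neighbours X e₁ e₃ (adj⇒≢ X e₂)
    excess-j : 1 ≤ excess X j
    excess-j = two-neighbours X (trans (adj-sym X j i) e₁) e₂ (adj⇒≢ X e₃)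

balance : ∀ {n} {G X : Graph n} → IsComplementOf G X → NoIsolatedVertex X →
  triangles G + triangles X + pairs (excess X) + edgesInTriples X ≡ triples n + suc (sumF (excess X)) C 2
balance {n} {G} {X} c d = begin
    triangles G + triangles X + p + edgesInTriples X
  ≡⟨ swap (triangles G + triangles X) p (edgesInTriples X) ⟩
    triangles G + triangles X + edgesInTriples X + p
  ≡⟨ cong (_+ p) (goodman {Y = G} {X} c) ⟩
    triples n + cherriesInTriples X + p
  ≡⟨ cong (λ z → triples n + z + p) (cherries X) ⟩
    triples n + sumF (λ v → degree X v C 2) + p
  ≡⟨ +-assoc (triples n) _ p ⟩
    triples n + (sumF (λ v → degree X v C 2) + p)
  ≡⟨ cong (λ z → triples n + (z + p)) (sumF-cong (λ v → cong (_C 2) (sym (suc-excess {X = X} d v)))) ⟩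
    triples n + (sumF (λ v → suc (excess X v) C 2) + p)
  ≡⟨ cong (triples n +_) (convexity (excess X)) ⟩
    triples n + suc (sumF (excess X)) C 2 ∎
  where
  open ≡-Reasoning
  p = pairs (excess X)
  swap : ∀ a b c → a + b + c ≡ a + c + b
  swap = solve-∀

-- The right-hand side of the balance identity only depends on n and e(X):
-- for X, U of equal size without isolated vertices and complements G, H,
--   t(G) + t(X) + Σ_{a<b} g_X(a) g_X(b) = t(H) + t(U) + Σ_{a<b} g_U(a) g_U(b).
balance-compare : ∀ {n} {G X H U : Graph n} → IsComplementOf G X → IsComplementOf H U →
  NoIsolatedVertex X → NoIsolatedVertex U → size X ≡ size U →
  triangles G + triangles X + pairs (excess X) ≡ triangles H + triangles U + pairs (excess U)
balance-compare {n} {G} {X} {H} {U} cG cH dX dU sz =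
  +-cancelʳ-≡ (edgesInTriples X) _ _ (begin
      triangles G + triangles X + pairs (excess X) + edgesInTriples X
    ≡⟨ balance {G = G} {X} cG dX ⟩
      triples n + suc (sumF (excess X)) C 2
    ≡⟨ cong (λ z → triples n + suc z C 2) same-excess ⟩
      triples n + suc (sumF (excess U)) C 2
    ≡⟨ sym (balance {G = H} {U} cH dU) ⟩
      triangles H + triangles U + pairs (excess U) + edgesInTriples U
    ≡⟨ cong (triangles H + triangles U + pairs (excess U) +_) (sym same-edges) ⟩
      triangles H + triangles U + pairs (excess U) + edgesInTriples X ∎)
  where
  open ≡-Reasoning
  same-edges : edgesInTriples X ≡ edgesInTriples U
  same-edges = +-cancelʳ-≡ (2 * size X) _ _
    (trans (edges-in-triples X) (trans (cong (n *_) sz)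
      (trans (sym (edges-in-triples U)) (cong (λ z → edgesInTriples U + 2 * z) (sym sz)))))
  same-excess : sumF (excess X) ≡ sumF (excess U)
  same-excess = +-cancelˡ-≡ n _ _ (trans (excess-sum X dX) (trans (cong (2 *_) sz) (sym (excess-sum U dU))))

-- The matching M_k and the star S_s

paired : ℕ → ℕ → Bool
paired x y = not (x ≡ᵇ y) ∧ ((x / 2 ≡ᵇ y / 2) ∨ (y / 2 ≡ᵇ x / 2))

matching-adj : ∀ k (i j : Fin (2 * k)) → adj (matching k) i j ≡ paired (toℕ i) (toℕ j)
matching-adj k i j = cong₂ _∧_ (cong not (eqb-toℕ i j))
  (cong₂ _∨_ (isYes≗does (toℕ i / 2 ℕ.≟ toℕ j / 2)) (isYes≗does (toℕ j / 2 ℕ.≟ toℕ i / 2)))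

half-suc-suc : ∀ y → suc (suc y) / 2 ≡ suc (y / 2)
half-suc-suc y = m/n≡1+[m∸n]/n {suc (suc y)} {2} (s≤s (s≤s z≤n))

paired-shift : ∀ x y → paired (suc (suc x)) (suc (suc y)) ≡ paired x y
paired-shift x y rewrite half-suc-suc x | half-suc-suc y = refl

paired-0 : ∀ y → paired 0 (suc (suc y)) ≡ false
paired-0 y rewrite half-suc-suc y = refl

paired-1 : ∀ y → paired 1 (suc (suc y)) ≡ false
paired-1 y rewrite half-suc-suc y = refl

paired-0′ : ∀ x → paired (suc (suc x)) 0 ≡ false
paired-0′ x rewrite half-suc-suc x = refl

paired-1′ : ∀ x → paired (suc (suc x)) 1 ≡ false
paired-1′ x rewrite half-suc-suc x = refl

matching-degree : ∀ k (i : Fin (2 * k)) → degree (matching k) i ≡ 1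
matching-degree k i = trans (sumF-cong (λ j → cong ι (matching-adj k i j)))
  (trans (sumF-toℕ {2 * k} (λ y → ι (paired (toℕ i) y))) (row k (toℕ i) (toℕ<n i)))
  where
  double-suc : ∀ k → 2 * suc k ≡ suc (suc (2 * k))
  double-suc = solve-∀
  row : ∀ k x → x < 2 * k → sumR (2 * k) (λ y → ι (paired x y)) ≡ 1
  row zero    x ()
  row (suc k) x p =
    subst (λ m → sumR m (λ y → ι (paired x y)) ≡ 1) (sym (double-suc k)) (row-suc x (subst (x <_) (double-suc k) p))
    where
    row-suc : ∀ x → x < suc (suc (2 * k)) → sumR (suc (suc (2 * k))) (λ y → ι (paired x y)) ≡ 1
    row-suc zero          _ = cong suc (trans (sumR-cong (2 * k) (λ y → cong ι (paired-0 y))) (sumR-0 (2 * k)))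
    row-suc (suc zero)    _ = cong suc (trans (sumR-cong (2 * k) (λ y → cong ι (paired-1 y))) (sumR-0 (2 * k)))
    row-suc (suc (suc x)) (s≤s (s≤s q)) = cong₂ _+_ (cong ι (paired-0′ x))
      (cong₂ _+_ (cong ι (paired-1′ x)) (trans (sumR-cong (2 * k) (λ y → cong ι (paired-shift x y))) (row k x q)))

-- Encoding of matching vertices: 2a + b (b ≤ 1) is end b of the a-th edge.
half : ∀ a b → b ≤ 1 → (2 * a + b) / 2 ≡ a
half zero    zero          _ = refl
half zero    (suc zero)    _ = refl
half zero    (suc (suc b)) (s≤s ())
half (suc a) b p = trans (cong (_/ 2) (double-suc a b)) (trans (half-suc-suc (2 * a + b)) (cong suc (half a b p)))
  where
  double-suc : ∀ a b → 2 * suc a + b ≡ suc (suc (2 * a + b))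
  double-suc = solve-∀

code-injective : ∀ a b a′ b′ → b ≤ 1 → b′ ≤ 1 → 2 * a + b ≡ 2 * a′ + b′ → (a ≡ a′) × (b ≡ b′)
code-injective a b a′ b′ p p′ e = same-edge , +-cancelˡ-≡ (2 * a) b b′ (trans e (cong (λ z → 2 * z + b′) (sym same-edge)))
  where
  same-edge : a ≡ a′
  same-edge = trans (sym (half a b p)) (trans (cong (_/ 2) e) (half a′ b′ p′))

≡ᵇ-true : ∀ {x y} → x ≡ y → (x ≡ᵇ y) ≡ true
≡ᵇ-true {x} refl = lemma x
  where
  lemma : ∀ x → (x ≡ᵇ x) ≡ true
  lemma zero    = refl
  lemma (suc x) = lemma x

≡ᵇ-sound : ∀ {x y} → (x ≡ᵇ y) ≡ true → x ≡ y
≡ᵇ-sound {x} {y} e = ≡ᵇ⇒≡ x y (subst T (sym e) _)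

≡ᵇ-sym : ∀ x y → (x ≡ᵇ y) ≡ (y ≡ᵇ x)
≡ᵇ-sym zero    zero    = refl
≡ᵇ-sym zero    (suc y) = refl
≡ᵇ-sym (suc x) zero    = refl
≡ᵇ-sym (suc x) (suc y) = ≡ᵇ-sym x y

bool-ext : ∀ {a b : Bool} → (a ≡ true → b ≡ true) → (b ≡ true → a ≡ true) → a ≡ b
bool-ext {true}  {true}  f g = refl
bool-ext {true}  {false} f g = sym (f refl)
bool-ext {false} {true}  f g = g refl
bool-ext {false} {false} f g = refl

¬true⇒false : ∀ {b} → ¬ b ≡ true → b ≡ false
¬true⇒false {true}  f = ⊥-elim (f refl)
¬true⇒false {false} f = refl

∧-true-l : ∀ {x y} → (x ∧ y) ≡ true → x ≡ true
∧-true-l {true} _ = refl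

∧-true-r : ∀ {x y} → (x ∧ y) ≡ true → y ≡ true
∧-true-r {true} e = e

code-≡ᵇ : ∀ a b a′ b′ → b ≤ 1 → b′ ≤ 1 → (2 * a + b ≡ᵇ 2 * a′ + b′) ≡ ((a ≡ᵇ a′) ∧ (b ≡ᵇ b′))
code-≡ᵇ a b a′ b′ p p′ = bool-ext forward backward
  where
  forward : (2 * a + b ≡ᵇ 2 * a′ + b′) ≡ true → ((a ≡ᵇ a′) ∧ (b ≡ᵇ b′)) ≡ true
  forward e with code-injective a b a′ b′ p p′ (≡ᵇ-sound e)
  ... | refl , refl rewrite ≡ᵇ-true {a} refl | ≡ᵇ-true {b} refl = refl
  backward : ((a ≡ᵇ a′) ∧ (b ≡ᵇ b′)) ≡ true → (2 * a + b ≡ᵇ 2 * a′ + b′) ≡ true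
  backward e = ≡ᵇ-true {2 * a + b} {2 * a′ + b′}
    (cong₂ (λ x y → 2 * x + y) (≡ᵇ-sound {a} (∧-true-l {a ≡ᵇ a′} e)) (≡ᵇ-sound {b} (∧-true-r {a ≡ᵇ a′} e)))

paired-code : ∀ a b a′ b′ → b ≤ 1 → b′ ≤ 1 → paired (2 * a + b) (2 * a′ + b′) ≡ ((a ≡ᵇ a′) ∧ not (b ≡ᵇ b′))
paired-code a b a′ b′ p p′ rewrite code-≡ᵇ a b a′ b′ p p′ | half a b p | half a′ b′ p′ | ≡ᵇ-sym a′ a =
  simplify (a ≡ᵇ a′) (b ≡ᵇ b′)
  where
  simplify : ∀ x y → not (x ∧ y) ∧ (x ∨ x) ≡ (x ∧ not y)
  simplify true  true  = refl
  simplify true  false = refl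
  simplify false y     = refl

star-centre-degree : ∀ s → degree (star (suc s)) zero ≡ s
star-centre-degree s = sumF-1 {s}

star-leaf-degree : ∀ s (i : Fin s) → degree (star (suc s)) (suc i) ≡ 1
star-leaf-degree s i = cong suc (trans (sumF-cong {s} (λ j → cong ι (∧-zeroʳ (neq (suc i) (suc j))))) (sumF-0 {s}))

mkGraph-adj : ∀ {n} (A : Graph n) x y → neq x y ∧ (adj A x y ∨ adj A y x) ≡ adj A x y
mkGraph-adj A x y with x ≟ y
... | yes refl rewrite adj-irrefl A x = refl
... | no _ rewrite adj-sym A y x with adj A x y
... | true  = refl
... | false = refl

data Side (a b : ℕ) : Fin (a + b) → Set where
  left  : (x : Fin a) → Side a b (x ↑ˡ b)
  right : (y : Fin b) → Side a b (a ↑ʳ y)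

side : ∀ a b (i : Fin (a + b)) → Side a b i
side a b i with splitAt a i | join-splitAt a b i
... | inj₁ x | refl = left x
... | inj₂ y | refl = right y

left≢right : ∀ {a b} (x : Fin a) (y : Fin b) → ¬ (x ↑ˡ b ≡ a ↑ʳ y)
left≢right {a} {b} x y e with trans (sym (splitAt-↑ˡ a x b)) (trans (cong (splitAt a) e) (splitAt-↑ʳ a b y))
... | ()

module DisjointUnion {a b : ℕ} (A : Graph a) (B : Graph b) where

  private
    U = disjointUnion A B

  adj-ll : ∀ (x y : Fin a) → adj U (x ↑ˡ b) (y ↑ˡ b) ≡ adj A x y
  adj-ll x y rewrite splitAt-↑ˡ a x b | splitAt-↑ˡ a y b =
    trans (cong (λ z → not z ∧ (adj A x y ∨ adj A y x)) (eqb-injective (_↑ˡ b) (↑ˡ-injective b _ _) x y))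
          (mkGraph-adj A x y)

  adj-rr : ∀ (x y : Fin b) → adj U (a ↑ʳ x) (a ↑ʳ y) ≡ adj B x y
  adj-rr x y rewrite splitAt-↑ʳ a b x | splitAt-↑ʳ a b y =
    trans (cong (λ z → not z ∧ (adj B x y ∨ adj B y x)) (eqb-injective (a ↑ʳ_) (↑ʳ-injective a _ _) x y))
          (mkGraph-adj B x y)

  adj-lr : ∀ (x : Fin a) (y : Fin b) → adj U (x ↑ˡ b) (a ↑ʳ y) ≡ false
  adj-lr x y rewrite splitAt-↑ˡ a x b | splitAt-↑ʳ a b y = ∧-zeroʳ _

  adj-rl : ∀ (x : Fin b) (y : Fin a) → adj U (a ↑ʳ x) (y ↑ˡ b) ≡ false
  adj-rl x y rewrite splitAt-↑ˡ a y b | splitAt-↑ʳ a b x = ∧-zeroʳ _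

  degree-l : ∀ (x : Fin a) → degree U (x ↑ˡ b) ≡ degree A x
  degree-l x = trans (sumF-split a b (E U (x ↑ˡ b)))
    (trans (cong₂ _+_ (sumF-cong (λ y → cong ι (adj-ll x y)))
                      (trans (sumF-cong (λ y → cong ι (adj-lr x y))) (sumF-0 {b})))
           (+-identityʳ _))

  degree-r : ∀ (y : Fin b) → degree U (a ↑ʳ y) ≡ degree B y
  degree-r y = trans (sumF-split a b (E U (a ↑ʳ y)))
    (cong₂ _+_ (trans (sumF-cong (λ x → cong ι (adj-rl y x))) (sumF-0 {a})) (sumF-cong (λ x → cong ι (adj-rr y x))))

-- The extremal complement U = M_k ∪ S_s with s = t + 2 (so the star has a
-- centre of degree t + 1 and at least one leaf).
module MatchingStar (k t : ℕ) where

  s : ℕ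
  s = suc (suc t)

  n : ℕ
  n = 2 * k + s

  U : Graph n
  U = disjointUnion (matching k) (star s)

  open DisjointUnion (matching k) (star s) public

  centre : Fin n
  centre = (2 * k) ↑ʳ zero

  U-no-isolated : NoIsolatedVertex U
  U-no-isolated v with side (2 * k) s v
  ... | left x        = ≤-reflexive (sym (trans (degree-l x) (matching-degree k x)))
  ... | right zero    = ≤-trans (s≤s z≤n) (≤-reflexive (sym (trans (degree-r zero) (star-centre-degree (suc t)))))
  ... | right (suc y) = ≤-reflexive (sym (trans (degree-r (suc y)) (star-leaf-degree (suc t) y)))

  U-excess : ∀ v → excess U v ≡ 0 ⊎ v ≡ centre
  U-excess v with side (2 * k) s v
  ... | left x        = inj₁ (cong (_∸ 1) (trans (degree-l x) (matching-degree k x)))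
  ... | right zero    = inj₂ refl
  ... | right (suc y) = inj₁ (cong (_∸ 1) (trans (degree-r (suc y)) (star-leaf-degree (suc t) y)))

  U-pairs : pairs (excess U) ≡ 0
  U-pairs = trans (sumF-cong (λ a → sumF-cong (λ b → term a b))) (trans (sumF-cong {n} (λ a → sumF-0 {n})) (sumF-0 {n}))
    where
    term : ∀ a b → L a b * (excess U a * excess U b) ≡ 0
    term a b with U-excess a | U-excess b
    ... | inj₁ e    | _ rewrite e = *-zeroʳ (L a b)
    ... | inj₂ _    | inj₁ e rewrite e | *-zeroʳ (excess U a) = *-zeroʳ (L a b)
    ... | inj₂ refl | inj₂ refl rewrite L-irr centre = refl

  U-degree-sum : sumF (degree U) ≡ 2 * k + 2 * suc t
  U-degree-sum = trans (sumF-split (2 * k) s (degree U)) (cong₂ _+_ matching-part star-part)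
    where
    matching-part : sumF (λ x → degree U (x ↑ˡ s)) ≡ 2 * k
    matching-part = trans (sumF-cong (λ x → trans (degree-l x) (matching-degree k x))) (sumF-1 {2 * k})
    double : ∀ t → suc t + suc t ≡ 2 * suc t
    double = solve-∀
    star-part : sumF (λ y → degree U ((2 * k) ↑ʳ y)) ≡ 2 * suc t
    star-part = trans (sumF-cong degree-r)
      (trans (cong₂ _+_ (star-centre-degree (suc t))
                        (trans (sumF-cong (star-leaf-degree (suc t))) (sumF-1 {suc t})))
             (double t))

  U-size : size U ≡ k + suc t
  U-size = *-cancelˡ-≡ (size U) (k + suc t) 2
    (trans (sym (handshake U)) (trans U-degree-sum (sym (*-distribˡ-+ 2 k (suc t)))))

-- A vertex maximising f (the given vertex only witnesses that Fin n is inhabited).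
argmax : ∀ {n} (f : Fin n → ℕ) → Fin n → Σ (Fin n) (λ c → ∀ v → f v ≤ f c)
argmax {suc zero}    f _ = zero , λ { zero → ≤-refl }
argmax {suc (suc n)} f _ with argmax (λ i → f (suc i)) zero
... | c , max with f (suc c) ≤? f zero
...   | yes p = zero  , λ { zero → ≤-refl ; (suc v) → ≤-trans (max v) p }
...   | no ¬p = suc c , λ { zero → ≤-trans (n≤1+n _) (≰⇒> ¬p) ; (suc v) → max v }

witness : ∀ {n} (f : Fin n → Bool) → 1 ≤ count f → Σ (Fin n) (λ w → f w ≡ true)
witness {suc n} f p with f zero in e
... | true  = zero , e
... | false with witness (λ i → f (suc i)) p
...   | w , q = suc w , q

rank : ∀ {n} → (Fin n → Bool) → Fin n → ℕ
rank P v = count (λ u → lt u v ∧ P u)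

rank-< : ∀ {n} (P : Fin n → Bool) {a b} → P a ≡ true → lt a b ≡ true → rank P a < rank P b
rank-< P {a} {b} pa ab = sumF-mono-< termwise a strict
  where
  termwise : ∀ u → ι (lt u a ∧ P u) ≤ ι (lt u b ∧ P u)
  termwise u with lt u a in e
  ... | false = z≤n
  ... | true rewrite lt-true {i = u} {b} (<-trans (lt-sound e) (lt-sound ab)) = ≤-refl
  strict : ι (lt a a ∧ P a) < ι (lt a b ∧ P a)
  strict rewrite lt-false {i = a} {a} (n≮n (toℕ a)) | ab | pa = s≤s z≤n

rank-bound : ∀ {n} (P : Fin n → Bool) {a} → P a ≡ true → rank P a < count P
rank-bound P {a} pa = sumF-mono-< termwise a strict
  where
  termwise : ∀ u → ι (lt u a ∧ P u) ≤ ι (P u)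
  termwise u with lt u a
  ... | false = z≤n
  ... | true  = ≤-refl
  strict : ι (lt a a ∧ P a) < ι (P a)
  strict rewrite lt-false {i = a} {a} (n≮n (toℕ a)) | pa = s≤s z≤n

rank-injective : ∀ {n} (P : Fin n → Bool) {a b} → P a ≡ true → P b ≡ true → rank P a ≡ rank P b → a ≡ b
rank-injective P {a} {b} pa pb e with Finₚ.<-cmp a b
... | tri< p _ _ = ⊥-elim (<-irrefl e (rank-< P pa (lt-true p)))
... | tri≈ _ q _ = q
... | tri> _ _ p = ⊥-elim (<-irrefl (sym e) (rank-< P pb (lt-true p)))

injective⇒surjective : ∀ {n} (f : Fin n → Fin n) → (∀ {x y} → f x ≡ f y → x ≡ y) → ∀ y → Σ (Fin n) (λ x → f x ≡ y)
injective⇒surjective {suc m} f inj y with any? (λ x → f x ≟ y)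
... | yes r = r
... | no ¬r = ⊥-elim (<-irrefl refl (injective⇒≤ {f = g} g-injective))
  where
  g : Fin (suc m) → Fin m
  g x = punchOut {i = y} {j = f x} (λ e → ¬r (x , sym e))
  g-injective : ∀ {x z} → g x ≡ g z → x ≡ z
  g-injective {x} {z} e = inj (punchOut-injective (λ e′ → ¬r (x , sym e′)) (λ e′ → ¬r (z , sym e′)) e)

injective⇒↔ : ∀ {n} (f : Fin n → Fin n) → (∀ {x y} → f x ≡ f y → x ≡ y) → Fin n ↔ Fin n
injective⇒↔ {n} f inj = mk↔ₛ′ f from from-right (λ x → inj (from-right (f x)))
  where
  from : Fin n → Fin n
  from y = proj₁ (injective⇒surjective f inj y)
  from-right : ∀ y → f (from y) ≡ y
  from-right y = proj₂ (injective⇒surjective f inj y)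

-- An injective map embedding X into U also embeds the complements; on a common
-- vertex set it is therefore an isomorphism of the complements.
complement-≅ : ∀ {n} {G X H U : Graph n} → IsComplementOf G X → IsComplementOf H U →
  (φ : Fin n → Fin n) → (∀ {x y} → φ x ≡ φ y → x ≡ y) → (∀ i j → adj X i j ≡ adj U (φ i) (φ j)) → G ≅ H
complement-≅ {G = G} {X} {H} {U} cG cH φ inj φ-adj = injective⇒↔ φ inj , preserves
  where
  preserves : ∀ i j → adj G i j ≡ adj H (φ i) (φ j)
  preserves i j = trans (cG i j) (trans (cong₂ (λ a b → not a ∧ not b) (sym (eqb-injective φ inj i j)) (φ-adj i j))
                                        (sym (cH (φ i) (φ j))))

-- Recognising M_k ∪ S_{t+2}
--
-- Let X have the vertex count and size of U, no isolated vertex, and all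
-- products of excesses zero.  Then a vertex c of maximum degree is the only
-- vertex of degree ≠ 1; its t + 1 neighbours are the leaves, and every other
-- vertex is matched to a unique partner, giving k edges.  Sending c to the
-- centre, the leaves (by rank) to the leaves of the star, and the partner
-- pairs (ranked by their smaller end) to the edges of M_k embeds X into U.
module Recognition (k t : ℕ) (X : Graph (MatchingStar.n k t)) (no-isolated : NoIsolatedVertex X)
                   (no-pairs : pairs (excess X) ≡ 0) (size-X : size X ≡ k + suc t) where

  open MatchingStar k t

  c : Fin n
  c = proj₁ (argmax (degree X) centre)

  c-max : ∀ v → degree X v ≤ degree X c
  c-max = proj₂ (argmax (degree X) centre)

  -- Every vertex other than c has degree one: its excess is at most that of c
  -- and their product vanishes.
  degree-other : ∀ v → ¬ v ≡ c → degree X v ≡ 1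
  degree-other v ne = trans (sym (suc-excess {X = X} no-isolated v))
    (cong suc (smaller-factor (pairs-zero (excess X) no-pairs v c ne) (∸-monoˡ-≤ 1 (c-max v))))
    where
    smaller-factor : ∀ {x y} → x * y ≡ 0 → x ≤ y → x ≡ 0
    smaller-factor {zero}              _  _  = refl
    smaller-factor {suc x} {suc y}     () _

  others : sumF (λ v → ι (neq v c)) + 1 ≡ n
  others = trans (cong (sumF (λ v → ι (neq v c)) +_) (sym (sumF-eqb c)))
    (trans (sym (sumF-+ (λ v → ι (neq v c)) (λ v → ι (eqb v c)))) (trans (sumF-cong one) (sumF-1 {n})))
    where
    one : ∀ v → ι (neq v c) + ι (eqb v c) ≡ 1
    one v with eqb v c
    ... | true  = refl
    ... | false = refl

  degree-sum : sumF (degree X) ≡ degree X c + sumF (λ v → ι (neq v c))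
  degree-sum = trans (sumF-cong split)
    (trans (sumF-+ (λ v → ι (eqb v c) * degree X c) (λ v → ι (neq v c)))
           (cong (_+ sumF (λ v → ι (neq v c))) (sumF-δ (λ _ → degree X c) c)))
    where
    split : ∀ v → degree X v ≡ ι (eqb v c) * degree X c + ι (neq v c)
    split v with v ≟ c
    ... | yes refl = sym (trans (+-identityʳ _) (+-identityʳ _))
    ... | no ne    = degree-other v ne

  c-degree : degree X c ≡ suc t
  c-degree = +-cancelʳ-≡ N (degree X c) (suc t) (+-cancelʳ-≡ 1 _ _ (begin
      degree X c + N + 1
    ≡⟨ cong (_+ 1) (sym degree-sum) ⟩
      sumF (degree X) + 1
    ≡⟨ cong (_+ 1) (trans (handshake X) (cong (2 *_) size-X)) ⟩
      2 * (k + suc t) + 1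
    ≡⟨ regroup k t ⟩
      suc t + (2 * k + suc (suc t))
    ≡⟨ cong (suc t +_) (sym others) ⟩
      suc t + (N + 1)
    ≡⟨ sym (+-assoc (suc t) N 1) ⟩
      suc t + N + 1 ∎))
    where
    open ≡-Reasoning
    N = sumF (λ v → ι (neq v c))
    regroup : ∀ k t → 2 * (k + suc t) + 1 ≡ suc t + (2 * k + suc (suc t))
    regroup = solve-∀

  leaf : Fin n → Bool
  leaf v = adj X c v

  matched : Fin n → Bool
  matched v = neq v c ∧ not (adj X c v)

  IsMatched : Fin n → Set
  IsMatched v = (¬ v ≡ c) × (adj X c v ≡ false)

  matched⇒ : ∀ {v} → matched v ≡ true → IsMatched v
  matched⇒ {v} e with v ≟ c | adj X c v
  ... | no ne | false = ne , refl

  ⇒matched : ∀ {v} → IsMatched v → matched v ≡ true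
  ⇒matched {v} (ne , e) rewrite eqb-false ne | e = refl

  classes : ∀ v → ι (eqb v c) + ι (leaf v) + ι (matched v) ≡ 1
  classes v with v ≟ c
  ... | yes refl rewrite adj-irrefl X v = refl
  ... | no _ with adj X c v
  ...   | true  = refl
  ...   | false = refl

  leaf≢c : ∀ {v} → leaf v ≡ true → ¬ v ≡ c
  leaf≢c e q = adj⇒≢ X e (sym q)

  leaf-neighbour : ∀ {v w} → leaf v ≡ true → adj X v w ≡ true → w ≡ c
  leaf-neighbour {v} e a = degree1-unique X v (degree-other v (leaf≢c e)) a (trans (adj-sym X v c) e)

  -- The partner of v: some neighbour (unique when v ≠ c).
  partner : Fin n → Fin n
  partner v = proj₁ (witness (adj X v) (no-isolated v))

  partner-adj : ∀ v → adj X v (partner v) ≡ true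
  partner-adj v = proj₂ (witness (adj X v) (no-isolated v))

  partner≢ : ∀ v → ¬ partner v ≡ v
  partner≢ v q = adj⇒≢ X (partner-adj v) (sym q)

  partner-unique : ∀ {v w} → IsMatched v → adj X v w ≡ true → w ≡ partner v
  partner-unique {v} (ne , _) a = degree1-unique X v (degree-other v ne) a (partner-adj v)

  partner≢c : ∀ {v} → IsMatched v → ¬ partner v ≡ c
  partner≢c {v} (_ , not-leaf) q with trans (sym not-leaf) (trans (adj-sym X c v) (subst (λ z → adj X v z ≡ true) q (partner-adj v)))
  ... | ()

  partner-matched : ∀ {v} → IsMatched v → IsMatched (partner v)
  partner-matched {v} m@(ne , _) = partner≢c m , not-leaf
    where
    not-leaf : adj X c (partner v) ≡ false
    not-leaf with adj X c (partner v) in h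
    ... | false = refl
    ... | true  = ⊥-elim (ne (leaf-neighbour h (trans (adj-sym X (partner v) v) (partner-adj v))))

  partner-involutive : ∀ {v} → IsMatched v → partner (partner v) ≡ v
  partner-involutive {v} m = sym (partner-unique (partner-matched m) (trans (adj-sym X (partner v) v) (partner-adj v)))

  matched-adj : ∀ {u} → IsMatched u → ∀ w → adj X u w ≡ eqb w (partner u)
  matched-adj {u} m w = bool-ext (λ a → eqb-true (partner-unique m a))
    (λ e → subst (λ z → adj X u z ≡ true) (sym (eqb-sound e)) (partner-adj u))

  count-matched : count matched ≡ 2 * k
  count-matched = +-cancelˡ-≡ (suc (suc t)) (count matched) (2 * k) (trans total (+-comm (2 * k) (suc (suc t))))
    where
    total : suc (suc t) + count matched ≡ n
    total = begin
        suc (suc t) + count matched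
      ≡⟨ cong (λ z → suc z + count matched) (sym c-degree) ⟩
        suc (degree X c) + count matched
      ≡⟨ cong (λ z → z + degree X c + count matched) (sym (sumF-eqb c)) ⟩
        sumF (λ v → ι (eqb v c)) + count leaf + count matched
      ≡⟨ cong (_+ count matched) (sym (sumF-+ (λ v → ι (eqb v c)) (λ v → ι (leaf v)))) ⟩
        sumF (λ v → ι (eqb v c) + ι (leaf v)) + count matched
      ≡⟨ sym (sumF-+ (λ v → ι (eqb v c) + ι (leaf v)) (λ v → ι (matched v))) ⟩
        sumF (λ v → ι (eqb v c) + ι (leaf v) + ι (matched v))
      ≡⟨ trans (sumF-cong classes) (sumF-1 {n}) ⟩
        n ∎
      where open ≡-Reasoning

  first : Fin n → Bool
  first v = matched v ∧ lt v (partner v)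

  matched-edge : Fin n → Fin n → ℕ
  matched-edge u w = ι (matched u) * (ι (matched w) * E X u w)

  matched-row : ∀ u → (w : Fin n) → matched u ≡ true → matched-edge u w ≡ ι (eqb w (partner u)) * ι (matched w)
  matched-row u w e rewrite e | matched-adj (matched⇒ e) w = reorder (ι (matched w)) (ι (eqb w (partner u)))
    where
    reorder : ∀ a b → 1 * (a * b) ≡ b * a
    reorder = solve-∀

  unmatched-row : ∀ u w → matched u ≡ false → matched-edge u w ≡ 0
  unmatched-row u w e = cong (λ z → ι z * (ι (matched w) * E X u w)) e

  matched-degree : ∀ u → sumF (matched-edge u) ≡ ι (matched u)
  matched-degree u = by-class (matched u) refl
    where
    by-class : ∀ b → matched u ≡ b → sumF (matched-edge u) ≡ ι (matched u)
    by-class false e = trans (trans (sumF-cong (λ w → unmatched-row u w e)) (sumF-0 {n})) (cong ι (sym e))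
    by-class true  e = begin
        sumF (matched-edge u)
      ≡⟨ sumF-cong (λ w → matched-row u w e) ⟩
        sumF (λ w → ι (eqb w (partner u)) * ι (matched w))
      ≡⟨ sumF-δ (λ w → ι (matched w)) (partner u) ⟩
        ι (matched (partner u))
      ≡⟨ cong ι (trans (⇒matched (partner-matched (matched⇒ e))) (sym e)) ⟩
        ι (matched u) ∎
      where open ≡-Reasoning

  matched-upper : ∀ u → sumF (λ w → L u w * matched-edge u w) ≡ ι (first u)
  matched-upper u = by-class (matched u) refl
    where
    by-class : ∀ b → matched u ≡ b → sumF (λ w → L u w * matched-edge u w) ≡ ι (first u)
    by-class false e = trans (sumF-cong (λ w → trans (cong (L u w *_) (unmatched-row u w e)) (*-zeroʳ (L u w))))
                             (trans (sumF-0 {n}) (cong (λ z → ι (z ∧ lt u (partner u))) (sym e)))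
    by-class true  e = begin
        sumF (λ w → L u w * matched-edge u w)
      ≡⟨ sumF-cong (λ w → trans (cong (L u w *_) (matched-row u w e)) (reorder (L u w) (ι (eqb w (partner u))) (ι (matched w)))) ⟩
        sumF (λ w → ι (eqb w (partner u)) * (L u w * ι (matched w)))
      ≡⟨ sumF-δ (λ w → L u w * ι (matched w)) (partner u) ⟩
        L u (partner u) * ι (matched (partner u))
      ≡⟨ cong (λ z → L u (partner u) * ι z) (⇒matched (partner-matched (matched⇒ e))) ⟩
        L u (partner u) * 1
      ≡⟨ *-identityʳ _ ⟩
        ι (lt u (partner u))
      ≡⟨ cong (λ z → ι (z ∧ lt u (partner u))) (sym e) ⟩
        ι (first u) ∎
      where
      open ≡-Reasoning
      reorder : ∀ l a b → l * (a * b) ≡ a * (l * b)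
      reorder = solve-∀

  count-first : count first ≡ k
  count-first = *-cancelˡ-≡ (count first) k 2 (sym (begin
      2 * k
    ≡⟨ sym count-matched ⟩
      count matched
    ≡⟨ sym (sumF-cong matched-degree) ⟩
      sumF (λ u → sumF (matched-edge u))
    ≡⟨ sumF-symmetric matched-edge symmetric diagonal ⟩
      2 * sumF (λ u → sumF (λ w → L u w * matched-edge u w))
    ≡⟨ cong (2 *_) (sumF-cong matched-upper) ⟩
      2 * count first ∎))
    where
    open ≡-Reasoning
    swap : ∀ a b e → a * (b * e) ≡ b * (a * e)
    swap = solve-∀
    symmetric : ∀ u w → matched-edge u w ≡ matched-edge w u
    symmetric u w rewrite E-sym X u w = swap (ι (matched u)) (ι (matched w)) (E X w u)
    diagonal : ∀ u → matched-edge u u ≡ 0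
    diagonal u rewrite E-irr X u | *-zeroʳ (ι (matched u)) = *-zeroʳ (ι (matched u))

  -- A matched vertex v is coded by 2 · (rank of the smaller end of its pair)
  -- + (0 if v is the smaller end, 1 otherwise).
  smaller : Fin n → Fin n
  smaller v = if lt v (partner v) then v else partner v

  end : Fin n → ℕ
  end v = ι (not (lt v (partner v)))

  pair-rank : Fin n → ℕ
  pair-rank v = rank first (smaller v)

  partner-order : ∀ v → lt (partner v) v ≡ not (lt v (partner v))
  partner-order v = lt-flip {a = v} {partner v} (λ q → partner≢ v (sym q))

  smaller-cases : ∀ v → (smaller v ≡ v) ⊎ (smaller v ≡ partner v)
  smaller-cases v with lt v (partner v)
  ... | true  = inj₁ refl
  ... | false = inj₂ refl

  smaller-first : ∀ {v} → IsMatched v → first (smaller v) ≡ true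
  smaller-first {v} m with lt v (partner v) in e
  ... | true rewrite ⇒matched m | e = refl
  ... | false rewrite ⇒matched (partner-matched m) | partner-involutive m | partner-order v | e = refl

  smaller-partner : ∀ {v} → IsMatched v → smaller (partner v) ≡ smaller v
  smaller-partner {v} m rewrite partner-involutive m | partner-order v with lt v (partner v)
  ... | true  = refl
  ... | false = refl

  end-partner : ∀ {v} → IsMatched v → (end v ≡ᵇ end (partner v)) ≡ false
  end-partner {v} m rewrite partner-involutive m | partner-order v with lt v (partner v)
  ... | true  = refl
  ... | false = refl

  same-pair : ∀ {i j} → IsMatched i → IsMatched j → smaller i ≡ smaller j → (i ≡ j) ⊎ (j ≡ partner i)
  same-pair {i} {j} mi mj e with smaller-cases i | smaller-cases j
  ... | inj₁ a | inj₁ b = inj₁ (trans (sym a) (trans e b))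
  ... | inj₁ a | inj₂ b = inj₂ (trans (sym (partner-involutive mj)) (cong partner (sym (trans (sym a) (trans e b)))))
  ... | inj₂ a | inj₁ b = inj₂ (sym (trans (sym a) (trans e b)))
  ... | inj₂ a | inj₂ b = inj₁ (trans (sym (partner-involutive mi)) (trans (cong partner (trans (sym a) (trans e b))) (partner-involutive mj)))

  code-bound : ∀ {v} → IsMatched v → 2 * pair-rank v + end v < 2 * k
  code-bound {v} m =
    ≤-trans (s≤s (+-monoʳ-≤ (2 * pair-rank v) (ι≤1 _))) (≤-trans (≤-reflexive (double (pair-rank v))) (*-monoʳ-≤ 2 rank<k))
    where
    rank<k : pair-rank v < k
    rank<k = subst (pair-rank v <_) count-first (rank-bound first (smaller-first m))
    double : ∀ r → suc (2 * r + 1) ≡ 2 * suc r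
    double = solve-∀

  leaf-bound : ∀ {v} → leaf v ≡ true → rank leaf v < suc t
  leaf-bound {v} e = subst (rank leaf v <_) c-degree (rank-bound leaf e)

  data Class (v : Fin n) : Set where
    is-c       : v ≡ c → Class v
    is-leaf    : leaf v ≡ true → Class v
    is-matched : IsMatched v → Class v

  class : ∀ v → Class v
  class v with v ≟ c | adj X c v in e
  ... | yes q | _     = is-c q
  ... | no ne | true  = is-leaf e
  ... | no ne | false = is-matched (ne , e)

  matched-code : ∀ {v} → IsMatched v → Fin (2 * k)
  matched-code m = fromℕ< (code-bound m)

  leaf-code : ∀ {v} → leaf v ≡ true → Fin s
  leaf-code e = suc (fromℕ< (leaf-bound e))

  φ′ : ∀ v → Class v → Fin n
  φ′ v (is-c _)       = (2 * k) ↑ʳ zero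
  φ′ v (is-leaf e)    = (2 * k) ↑ʳ leaf-code e
  φ′ v (is-matched m) = matched-code m ↑ˡ s

  matched-code-adj : ∀ {i j} (mi : IsMatched i) (mj : IsMatched j) →
    adj X i j ≡ adj U (matched-code mi ↑ˡ s) (matched-code mj ↑ˡ s)
  matched-code-adj {i} {j} mi mj = sym (begin
      adj U (matched-code mi ↑ˡ s) (matched-code mj ↑ˡ s)
    ≡⟨ adj-ll (matched-code mi) (matched-code mj) ⟩
      adj (matching k) (matched-code mi) (matched-code mj)
    ≡⟨ matching-adj k (matched-code mi) (matched-code mj) ⟩
      paired (toℕ (matched-code mi)) (toℕ (matched-code mj))
    ≡⟨ cong₂ paired (toℕ-fromℕ< (code-bound mi)) (toℕ-fromℕ< (code-bound mj)) ⟩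
      paired (2 * pair-rank i + end i) (2 * pair-rank j + end j)
    ≡⟨ paired-code (pair-rank i) (end i) (pair-rank j) (end j) (ι≤1 _) (ι≤1 _) ⟩
      ((pair-rank i ≡ᵇ pair-rank j) ∧ not (end i ≡ᵇ end j))
    ≡⟨ bool-ext partners adjacent ⟩
      adj X i j ∎)
    where
    open ≡-Reasoning
    partners : ((pair-rank i ≡ᵇ pair-rank j) ∧ not (end i ≡ᵇ end j)) ≡ true → adj X i j ≡ true
    partners e with same-pair mi mj (rank-injective first (smaller-first mi) (smaller-first mj) (≡ᵇ-sound (∧-true-l e)))
    ... | inj₁ refl with trans (sym (∧-true-r {pair-rank i ≡ᵇ pair-rank i} e)) (cong not (≡ᵇ-true {end i} refl))
    ...   | ()
    partners e | inj₂ refl = partner-adj i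
    adjacent : adj X i j ≡ true → ((pair-rank i ≡ᵇ pair-rank j) ∧ not (end i ≡ᵇ end j)) ≡ true
    adjacent a with partner-unique mi a
    ... | refl rewrite smaller-partner mi | ≡ᵇ-true {rank first (smaller i)} refl | end-partner mi = refl

  φ′-adj : ∀ i j (ci : Class i) (cj : Class j) → adj X i j ≡ adj U (φ′ i ci) (φ′ j cj)
  φ′-adj i j (is-c refl)     (is-c refl)     = trans (adj-irrefl X c) (sym (adj-irrefl U ((2 * k) ↑ʳ zero)))
  φ′-adj i j (is-c refl)     (is-leaf e)     = trans e (sym (adj-rr zero (leaf-code e)))
  φ′-adj i j (is-c refl)     (is-matched m)  = trans (proj₂ m) (sym (adj-rl zero (matched-code m)))
  φ′-adj i j (is-leaf e)     (is-c refl)     = trans (trans (adj-sym X i c) e) (sym (adj-rr (leaf-code e) zero))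
  φ′-adj i j (is-leaf e₁)    (is-leaf e₂)    =
    trans (¬true⇒false (λ a → leaf≢c e₂ (leaf-neighbour e₁ a))) (sym (trans (adj-rr (leaf-code e₁) (leaf-code e₂)) (∧-zeroʳ _)))
  φ′-adj i j (is-leaf e)     (is-matched m)  =
    trans (¬true⇒false (λ a → proj₁ m (leaf-neighbour e a))) (sym (adj-rl (leaf-code e) (matched-code m)))
  φ′-adj i j (is-matched m)  (is-c refl)     = trans (trans (adj-sym X i c) (proj₂ m)) (sym (adj-lr (matched-code m) zero))
  φ′-adj i j (is-matched m)  (is-leaf e)     =
    trans (trans (adj-sym X i j) (¬true⇒false (λ a → proj₁ m (leaf-neighbour e a)))) (sym (adj-lr (matched-code m) (leaf-code e)))
  φ′-adj i j (is-matched mi) (is-matched mj) = matched-code-adj mi mj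

  matched-code-injective : ∀ {i j} (mi : IsMatched i) (mj : IsMatched j) → matched-code mi ≡ matched-code mj → i ≡ j
  matched-code-injective {i} {j} mi mj eq = from-parts (code-injective (pair-rank i) (end i) (pair-rank j) (end j) (ι≤1 _) (ι≤1 _)
    (trans (sym (toℕ-fromℕ< (code-bound mi))) (trans (cong toℕ eq) (toℕ-fromℕ< (code-bound mj)))))
    where
    from-parts : (pair-rank i ≡ pair-rank j) × (end i ≡ end j) → i ≡ j
    from-parts (same-rank , same-end)
      with same-pair mi mj (rank-injective first (smaller-first mi) (smaller-first mj) same-rank)
    ... | inj₁ q = q
    ... | inj₂ q = ⊥-elim (true≢false (trans (sym (≡ᵇ-true same-end)) (trans (cong (λ z → end i ≡ᵇ end z) q) (end-partner mi))))
      where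
      true≢false : ¬ true ≡ false
      true≢false ()

  φ′-injective : ∀ i j (ci : Class i) (cj : Class j) → φ′ i ci ≡ φ′ j cj → i ≡ j
  φ′-injective i j (is-c p)        (is-c q)        _  = trans p (sym q)
  φ′-injective i j (is-c p)        (is-leaf e)     eq = ⊥-elim (Finₚ.0≢1+n (↑ʳ-injective (2 * k) zero (leaf-code e) eq))
  φ′-injective i j (is-leaf e)     (is-c p)        eq = ⊥-elim (Finₚ.0≢1+n (↑ʳ-injective (2 * k) zero (leaf-code e) (sym eq)))
  φ′-injective i j (is-leaf e₁)    (is-leaf e₂)    eq = rank-injective leaf e₁ e₂
    (trans (sym (toℕ-fromℕ< (leaf-bound e₁)))
      (trans (cong toℕ (Fin-suc-injective (↑ʳ-injective (2 * k) (leaf-code e₁) (leaf-code e₂) eq))) (toℕ-fromℕ< (leaf-bound e₂))))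
  φ′-injective i j (is-c p)        (is-matched m)  eq = ⊥-elim (left≢right (matched-code m) zero (sym eq))
  φ′-injective i j (is-leaf e)     (is-matched m)  eq = ⊥-elim (left≢right (matched-code m) (leaf-code e) (sym eq))
  φ′-injective i j (is-matched m)  (is-c p)        eq = ⊥-elim (left≢right (matched-code m) zero eq)
  φ′-injective i j (is-matched m)  (is-leaf e)     eq = ⊥-elim (left≢right (matched-code m) (leaf-code e) eq)
  φ′-injective i j (is-matched mi) (is-matched mj) eq =
    matched-code-injective mi mj (↑ˡ-injective s (matched-code mi) (matched-code mj) eq)

  φ : Fin n → Fin n
  φ v = φ′ v (class v)

  φ-injective : ∀ {i j} → φ i ≡ φ j → i ≡ j
  φ-injective {i} {j} = φ′-injective i j (class i) (class j)

  φ-adj : ∀ i j → adj X i j ≡ adj U (φ i) (φ j)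
  φ-adj i j = φ′-adj i j (class i) (class j)

-- The extremal graph H = complement (M_k ∪ S_{t+2})

bounded⇒no-isolated : ∀ {n} {Y X : Graph n} → IsComplementOf Y X → ∀ v → degree Y v + 2 ≤ n → 1 ≤ degree X v
bounded⇒no-isolated {n} {Y} {X} c v bound = s≤s⁻¹ (+-cancelˡ-≤ (degree Y v) 2 (suc (degree X v)) (begin
    degree Y v + 2
  ≤⟨ bound ⟩
    n
  ≡⟨ sym (complement-degree {Y = Y} {X} c v) ⟩
    degree Y v + degree X v + 1
  ≡⟨ regroup (degree Y v) (degree X v) ⟩
    degree Y v + suc (degree X v) ∎))
  where
  open ≤-Reasoning
  regroup : ∀ a b → a + b + 1 ≡ a + suc b
  regroup = solve-∀

no-isolated⇒bounded : ∀ {n} {Y X : Graph n} → IsComplementOf Y X → ∀ v → 1 ≤ degree X v → degree Y v + 2 ≤ n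
no-isolated⇒bounded {n} {Y} {X} c v d = begin
    degree Y v + 2
  ≤⟨ +-monoʳ-≤ (degree Y v) (s≤s d) ⟩
    degree Y v + suc (degree X v)
  ≡⟨ regroup (degree Y v) (degree X v) ⟩
    degree Y v + degree X v + 1
  ≡⟨ complement-degree {Y = Y} {X} c v ⟩
    n ∎
  where
  open ≤-Reasoning
  regroup : ∀ a b → a + suc b ≡ a + b + 1
  regroup = solve-∀

module Extremal (k t : ℕ) where

  open MatchingStar k t

  H : Graph n
  H = complement U

  H-size : size H + (k + suc t) ≡ n C 2
  H-size = trans (cong (size H +_) (sym U-size)) (complement-size {Y = H} {U} (complement-is U))

  H-degree : ∀ v → degree H v + 2 ≤ n
  H-degree v = no-isolated⇒bounded {Y = H} {U} (complement-is U) v (U-no-isolated v)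

  -- Every graph with the size of H and maximum degree ≤ n − 2 has at most as
  -- many triangles as H, and equality only for copies of H:
  --   t(H) = t(G) + t(X) + Σ_{a<b} g(a) g(b),   X the complement of G.
  H-maximal : ∀ {N} → n ≡ N → (G : Graph N) → size G ≡ size H → (∀ v → degree G v + 2 ≤ N) →
    triangles G ≤ triangles H × (triangles G ≡ triangles H → G ≅ H)
  H-maximal refl G size-G bound = at-most , equality
    where
    X : Graph n
    X = complement G
    cG : IsComplementOf G X
    cG = complement-is′ G
    cH : IsComplementOf H U
    cH = complement-is U
    X-no-isolated : NoIsolatedVertex X
    X-no-isolated v = bounded⇒no-isolated {Y = G} {X} cG v (bound v)
    size-X : size X ≡ size U
    size-X = +-cancelˡ-≡ (size G) _ _
      (trans (trans (complement-size {Y = G} {X} cG) (sym (complement-size {Y = H} {U} cH))) (cong (_+ size U) (sym size-G)))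
    gap : triangles H ≡ triangles G + triangles X + pairs (excess X)
    gap = sym (trans (balance-compare {G = G} {X} {H} {U} cG cH X-no-isolated U-no-isolated size-X)
                     (trans (cong₂ (λ a b → triangles H + a + b) (triangle-free U U-pairs) U-pairs)
                            (trans (+-identityʳ _) (+-identityʳ _))))
    at-most : triangles G ≤ triangles H
    at-most = ≤-trans (≤-trans (m≤m+n _ _) (m≤m+n _ _)) (≤-reflexive (sym gap))
    equality : triangles G ≡ triangles H → G ≅ H
    equality same = complement-≅ {G = G} {X} {H} {U} cG cH φ φ-injective φ-adj
      where
      no-pairs : pairs (excess X) ≡ 0
      no-pairs = m+n≡0⇒n≡0 (triangles X) (+-cancelˡ-≡ (triangles G) _ 0
        (trans (sym (+-assoc (triangles G) _ _)) (trans (sym gap) (trans (sym same) (sym (+-identityʳ _))))))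
      open Recognition k t X X-no-isolated no-pairs (trans size-X U-size)

two-C2 : ∀ n → 2 * (suc n C 2) ≡ suc n * n
two-C2 zero    = refl
two-C2 (suc n) =
  trans (cong (2 *_) (C2-suc (suc n)))
        (trans (*-distribˡ-+ 2 (suc n) (suc n C 2)) (trans (cong (2 * suc n +_) (two-C2 n)) (expand n)))
  where
  expand : ∀ n → 2 * suc n + suc n * n ≡ suc (suc n) * suc n
  expand = solve-∀

-- For C(r+1, 2) ≤ m, 2m ≤ (r+2) r, k = m − C(r+1, 2) and t = r − 2k, the star
-- has s = (r+1)² + 1 − 2m = t + 2 vertices, M_k ∪ S_s has r + 2 vertices, and
-- m + e(M_k ∪ S_s) = C(r+2, 2).
parameters : ∀ r m → (r + 1) C 2 ≤ m → 2 * m ≤ (r + 2) * r →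
  Σ ℕ λ t → ((r + 1) ^ 2 + 1 ∸ 2 * m ≡ suc (suc t))
          × (2 * (m ∸ (r + 1) C 2) + suc (suc t) ≡ r + 2)
          × (m + ((m ∸ (r + 1) C 2) + suc t) ≡ (r + 2) C 2)
parameters r m c≤m bound = t , star-order , order , size-sum
  where
  c k t : ℕ
  c = (r + 1) C 2
  k = m ∸ c
  c+k : c + k ≡ m
  c+k = m+[n∸m]≡n c≤m
  two-c : 2 * c ≡ suc r * r
  two-c = trans (cong (λ x → 2 * (x C 2)) (+-comm r 1)) (two-C2 r)
  2k≤r : 2 * k ≤ r
  2k≤r = +-cancelˡ-≤ (2 * c) (2 * k) r (begin
      2 * c + 2 * k   ≡⟨ sym (*-distribˡ-+ 2 c k) ⟩
      2 * (c + k)     ≡⟨ cong (2 *_) c+k ⟩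
      2 * m           ≤⟨ bound ⟩
      (r + 2) * r     ≡⟨ expand r ⟩
      suc r * r + r   ≡⟨ cong (_+ r) (sym two-c) ⟩
      2 * c + r       ∎)
    where
    open ≤-Reasoning
    expand : ∀ r → (r + 2) * r ≡ suc r * r + r
    expand = solve-∀
  t = r ∸ 2 * k
  2k+t : 2 * k + t ≡ r
  2k+t = m+[n∸m]≡n 2k≤r
  star-order : (r + 1) ^ 2 + 1 ∸ 2 * m ≡ suc (suc t)
  star-order = trans (cong (_∸ 2 * m) total) (m+n∸m≡n (2 * m) (suc (suc t)))
    where
    square : ∀ r → (r + 1) ^ 2 + 1 ≡ suc r * r + (r + 2)
    square r = expand r
      where
      expand : ∀ r → (r + 1) * ((r + 1) * 1) + 1 ≡ suc r * r + (r + 2)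
      expand = solve-∀
    open ≡-Reasoning
    regroup : ∀ c k t → 2 * c + (2 * k + t + 2) ≡ 2 * (c + k) + suc (suc t)
    regroup = solve-∀
    total : (r + 1) ^ 2 + 1 ≡ 2 * m + suc (suc t)
    total = begin
        (r + 1) ^ 2 + 1                ≡⟨ square r ⟩
        suc r * r + (r + 2)            ≡⟨ cong (_+ (r + 2)) (sym two-c) ⟩
        2 * c + (r + 2)                ≡⟨ cong (λ z → 2 * c + (z + 2)) (sym 2k+t) ⟩
        2 * c + (2 * k + t + 2)        ≡⟨ regroup c k t ⟩
        2 * (c + k) + suc (suc t)      ≡⟨ cong (λ z → 2 * z + suc (suc t)) c+k ⟩
        2 * m + suc (suc t)            ∎
  order : 2 * k + suc (suc t) ≡ r + 2
  order = trans (regroup k t) (cong (_+ 2) 2k+t)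
    where
    regroup : ∀ k t → 2 * k + suc (suc t) ≡ 2 * k + t + 2
    regroup = solve-∀
  size-sum : m + (k + suc t) ≡ (r + 2) C 2
  size-sum = begin
      m + (k + suc t)          ≡⟨ cong (_+ (k + suc t)) (sym c+k) ⟩
      c + k + (k + suc t)      ≡⟨ regroup c k t ⟩
      suc (2 * k + t) + c      ≡⟨ cong (λ z → suc z + c) 2k+t ⟩
      suc r + c                ≡⟨ cong (λ x → suc r + x C 2) (+-comm r 1) ⟩
      suc r + suc r C 2        ≡⟨ sym (C2-suc (suc r)) ⟩
      suc (suc r) C 2          ≡⟨ cong (_C 2) (+-comm 2 r) ⟩
      (r + 2) C 2              ∎
    where
    open ≡-Reasoning
    regroup : ∀ c k t → c + k + (k + suc t) ≡ suc (2 * k + t) + c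
    regroup = solve-∀

proposition1 : (r m : ℕ) → 1 ≤ r → (r + 1) C 2 ≤ m → 2 * m ≤ (r + 2) * r →
    let k = m ∸ (r + 1) C 2
        s = (r + 1) ^ 2 + 1 ∸ 2 * m
        H = complement (disjointUnion (matching k) (star s))
    in ((2 * k + s ≡ r + 2) × size H ≡ m × MaxDegreeAtMost H r)
       × ((G : Graph (r + 2)) → size G ≡ m → MaxDegreeAtMost G r →
            triangles G ≤ triangles H × (triangles G ≡ triangles H → G ≅ H))
proposition1 r m _ c≤m bound with parameters r m c≤m bound
... | t , star-order , order , size-sum rewrite star-order =
  (order , size-H , max-degree) , λ G size-G Δ-G → H-maximal order G (trans size-G (sym size-H)) (λ v → +-monoˡ-≤ 2 (Δ-G v))
  where
  open Extremal (m ∸ (r + 1) C 2) t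
  size-H : size H ≡ m
  size-H = +-cancelʳ-≡ _ (size H) m (trans H-size (trans (cong (_C 2) order) (sym size-sum)))
  max-degree : MaxDegreeAtMost H r
  max-degree v = +-cancelʳ-≤ 2 (degree H v) r (subst (degree H v + 2 ≤_) order (H-degree v))
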